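{- Let $p_\phi$ be a program that is safe with respect to a variable typing environment $\Gamma$ and a safe operator typing environment $\Delta$. Then there is a polynomial $P$ such that for every oracle $\phi$, every store $\mu$ and every derivation $\pi_\phi:\mu\models p_\phi\to w$, we have $|\pi_\phi|\le P(m_\mu^{p_\phi})$.
   Context: Words and programs. Fix a finite alphabet $\Sigma\supseteq\{0,1\}$ and let $\mathbb{W}=\Sigma^*$ ($\epsilon$ the empty word, $|w|$ the length of $w$); $v\unlhd w$ means $w=u.v.u'$ for some words $u,u'$. Fix a set $\mathbb{V}$ of variables and a set of operators, each operator $\mathtt{op}$ having an arity $ar(\mathtt{op})\ge 0$ and a total function $[\![\mathtt{op}]\!]:\mathbb{W}^{ar(\mathtt{op})}\to\mathbb{W}$. With a single oracle symbol $\phi$: expressions $e::=x\mid \mathtt{op}(e_1,\dots,e_{ar(\mathtt{op})})\mid \phi(e_1\upharpoonright e_2)$; commands $c::=\mathtt{skip}\mid x:=e\mid c_1;c_2\mid \mathtt{if}(e)\{c_1\}\,\mathtt{else}\,\{c_0\}\mid \mathtt{while}(e)\{c\}$; programs $p_\phi::=c\ \mathtt{return}\ x$. Semantics. For $w\in\mathbb{W}$, $n\in\mathbb{N}$, $w_{\upharpoonright n}$ is $w$ truncated to its first $\min(n,|w|)$ symbols followed by a word $10^k$ making the length exactly $n+1$; $[\![\upharpoonright]\!](v,w)=v_{\upharpoonright |w|}$. An oracle is a total function $\phi:\mathbb{W}\to\mathbb{W}$. A store is a partial map $\mu:\mathbb{V}\to\mathbb{W}$, of size $|\mu|=\sum_{x\in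 dom(\mu)}|\mu(x)|$. Given $\phi$, the deterministic big-step semantics is given by the rules: $\mu\models x\to\mu(x)$; $\mu\models\mathtt{op}(\bar e)\to[\![\mathtt{op}]\!](\bar w)$ if $\mu\models e_i\to w_i$ for all $i$; (oracle rule) $\mu\models\phi(e_1\upharpoonright e_2)\to\phi([\![\upharpoonright]\!](v,w))$ if $\mu\models e_1\to v$, $\mu\models e_2\to w$; $\mu\models\mathtt{skip}\to\mu$; $\mu\models x:=e\to\mu[x\leftarrow w]$ if $\mu\models e\to w$; $\mu\models c_1;c_2\to\mu_2$ if $\mu\models c_1\to\mu_1$ and $\mu_1\models c_2\to\mu_2$; $\mu\models\mathtt{if}(e)\{c_1\}\mathtt{else}\{c_0\}\to\mu'$ if $\mu\models e\to b$ with $b\in\{0,1\}$ and $\mu\models c_b\to\mu'$; $\mu\models\mathtt{while}(e)\{c\}\to\mu$ if $\mu\models e\to 0$; $\mu\models\mathtt{while}(e)\{c\}\to\mu'$ if $\mu\models e\to1$ and $\mu\models c;\mathtt{while}(e)\{c\}\to\mu'$; $\mu\models c\ \mathtt{return}\ x\to\mu'(x)$ if $\mu\models c\to\mu'$. A derivation $\pi_\phi$ is a proof tree built from these rules; $|\pi_\phi|$ is its number of nodes. $m_\mu^{p_\phi}$ is the maximum of $|\mu|$ and of the lengths $|\phi([\![\upharpoonright]\!](v,w))|$ over all applications of the oracle rule occurring in $\pi_\phi:\mu\models p_\phi\to w$. Operators. $\mathtt{op}$ is neutral if $ar(\mathtt{op})=0$, or $[\![\mathtt{op}]\!]$ takes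 values in $\{0,1\}$, or for all $\bar w$ there is $i$ with $[\![\mathtt{op}]\!](\bar w)\unlhd w_i$. $\mathtt{op}$ is positive if there is a constant $c$ with $|[\![\mathtt{op}]\!](\bar w)|\le\max_i|w_i|+c$ for all $\bar w$. Typing. Tiers are natural numbers $\mathbf 0,\mathbf 1,\dots$ with the usual order $\preceq$ (strict: $\prec$), $\vee=\max$, $\wedge=\min$. A variable typing environment $\Gamma$ maps variables to tiers; an operator typing environment $\Delta$ assigns to each operator $\mathtt{op}$ and tier $t$ a set $\Delta(\mathtt{op})(t)$ of types $t_1\to\dots\to t_{ar(\mathtt{op})}\to t'$. Judgments $\Gamma,\Delta\vdash b:(t,t_{in},t_{out})$ are derived by the rules (writing $\vdash$ for $\Gamma,\Delta\vdash$, all tiers arbitrary): (V) $\vdash x:(\Gamma(x),t_{in},t_{out})$; (OP) if $t_1\to\dots\to t_n\to t\in\Delta(\mathtt{op})(t_{in})$ and $\vdash e_i:(t_i,t_{in},t_{out})$ for all $i\le n=ar(\mathtt{op})$ then $\vdash\mathtt{op}(e_1,\dots,e_n):(t,t_{in},t_{out})$; (OR) if $\vdash e_1:(t,t_{in},t_{out})$, $\vdash e_2:(t_{out},t_{in},t_{out})$, $t\prec t_{in}$ and $t\preceq t_{out}$ then $\vdash\phi(e_1\upharpoonright e_2):(t,t_{in},t_{out})$; (SUB) for a command $c$, if $\vdash c:(t,t_{in},t_{out})$ then $\vdash c:(t+1,t_{in},t_{out})$; (SK) $\vdash\mathtt{skip}:(\mathbf0,t_{in},t_{out})$; (A) if $\vdash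 x:(t_1,t_{in},t_{out})$, $\vdash e:(t_2,t_{in},t_{out})$, $t_1\preceq t_2$ then $\vdash x:=e:(t_1,t_{in},t_{out})$; (S) if $\vdash c_1:\tau$ and $\vdash c_2:\tau$ then $\vdash c_1;c_2:\tau$; (C) if $\vdash e:\tau$, $\vdash c_1:\tau$, $\vdash c_0:\tau$ then $\vdash\mathtt{if}(e)\{c_1\}\mathtt{else}\{c_0\}:\tau$; (W) if $\vdash e:(t,t_{in},t_{out})$, $\vdash c:(t,t,t_{out})$ and $\mathbf1\preceq t\preceq t_{out}$ then $\vdash\mathtt{while}(e)\{c\}:(t,t_{in},t_{out})$; (W$_0$) if $\vdash e:(t,t_{in},t)$, $\vdash c:(t,t,t)$ and $\mathbf1\preceq t$ then $\vdash\mathtt{while}(e)\{c\}:(t,t_{in},\mathbf0)$. Safety. $\Delta$ is safe if for each operator $\mathtt{op}$ it types with $ar(\mathtt{op})>0$: $\mathtt{op}$ is neutral or positive, $[\![\mathtt{op}]\!]$ is polynomial-time computable, and for every tier $t_{in}$ and every $t_1\to\dots\to t_n\to t\in\Delta(\mathtt{op})(t_{in})$: $t\preceq\wedge_i t_i\preceq\vee_i t_i\preceq t_{in}$, and $t\prec t_{in}$ if $\mathtt{op}$ is positive but not neutral. A program $c\ \mathtt{return}\ x$ is safe with respect to $\Gamma,\Delta$ if $\Delta$ is safe and $\Gamma,\Delta\vdash c:(t,t_{in},t_{out})$ for some tiers. -}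

module Defs where

open import Data.Nat using (ℕ; zero; suc; _+_; _*_; _∸_; _≤_; _<_; _⊔_; _⊓_)
open import Data.Fin using (Fin)
open import Data.List using (List; []; _∷_; _++_; take; replicate; length)
open import Data.Vec using (Vec; []; _∷_)
import Data.Vec as V
open import Data.Maybe using (Maybe; just; nothing)
open import Data.Product using (Σ; ∃; _×_; _,_)
open import Data.Sum using (_⊎_)
open import Relation.Binary.PropositionalEquality using (_≡_)
open import Relation.Nullary using (¬_)

Sym : ℕ → Set
Sym k = Fin (suc (suc k))

Word : ℕ → Set
Word k = List (Sym k)

sym0 : ∀ {k} → Sym k
sym0 = Fin.zero

sym1 : ∀ {k} → Sym k
sym1 = Fin.suc Fin.zero

w0 : ∀ {k} → Word k
w0 = sym0 ∷ []

w1 : ∀ {k} → Word k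
w1 = sym1 ∷ []

_⊴_ : ∀ {k} → Word k → Word k → Set
v ⊴ w = Σ _ λ u → Σ _ λ u' → w ≡ u ++ (v ++ u')

trunc : ∀ {k} → Word k → ℕ → Word k
trunc w n = take n w ++ (sym1 ∷ replicate (n ∸ length w) sym0)

restrict : ∀ {k} → Word k → Word k → Word k
restrict v w = trunc v (length w)

record Signature : Set₁ where
  field
    k   : ℕ
    Op  : Set
    ar  : Op → ℕ
    sem : (o : Op) → Vec (Word k) (ar o) → Word k

Var : Set
Var = ℕ

Tier : Set
Tier = ℕ

vmax : ∀ {n} → Vec ℕ n → ℕ
vmax []       = 0
vmax (x ∷ xs) = x ⊔ vmax xs

-- minimum of a vector (only used for non-empty vectors)
vmin : ∀ {n} → Vec ℕ n → ℕ
vmin []           = 0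
vmin (x ∷ [])     = x
vmin (x ∷ y ∷ xs) = x ⊓ vmin (y ∷ xs)

-- Polynomials with natural-number coefficients (a₀ ∷ a₁ ∷ …)
Poly : Set
Poly = List ℕ

evalPoly : Poly → ℕ → ℕ
evalPoly []       x = 0
evalPoly (a ∷ as) x = a + x * evalPoly as x

module _ (S : Signature) where
  open Signature S

  W : Set
  W = Word k

  data Expr : Set where
    var : Var → Expr
    op  : (o : Op) → Vec Expr (ar o) → Expr
    orc : Expr → Expr → Expr              -- φ(e₁ ↾ e₂)

  data Cmd : Set where
    skip  : Cmd
    _≔_   : Var → Expr → Cmd
    _⨟_   : Cmd → Cmd → Cmd
    ifte  : Expr → Cmd → Cmd → Cmd
    while : Expr → Cmd → Cmd

  record Program : Set where
    constructor _return_
    field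
      body : Cmd
      ret  : Var

  Neutral : Op → Set
  Neutral o = (ar o ≡ 0)
            ⊎ ((ws : Vec W (ar o)) → (sem o ws ≡ w0) ⊎ (sem o ws ≡ w1))
            ⊎ ((ws : Vec W (ar o)) → ∃ λ i → sem o ws ⊴ V.lookup ws i)

  Positive : Op → Set
  Positive o = ∃ λ c → (ws : Vec W (ar o)) →
                 length (sem o ws) ≤ vmax (V.map length ws) + c

  VarEnv : Set
  VarEnv = Var → Tier

  -- Δ(op)(t_in) is a set of types t₁ → … → tₙ → t, given as a predicate
  -- on (t₁,…,tₙ) and t.
  OpEnv : Set₁
  OpEnv = (o : Op) → (tin : Tier) → Vec Tier (ar o) → Tier → Set

  -- Predicate "the function is polynomial-time computable" (abstract).
  PolyTimePred : Set₁
  PolyTimePred = (n : ℕ) → (Vec W n → W) → Set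

  SafeOpEnv : PolyTimePred → OpEnv → Set
  SafeOpEnv PT Δ =
    (o : Op) → 0 < ar o → (∃ λ tin → ∃ λ ts → ∃ λ t → Δ o tin ts t) →
      (Neutral o ⊎ Positive o)
    × PT (ar o) (sem o)
    × ((tin : Tier) (ts : Vec Tier (ar o)) (t : Tier) → Δ o tin ts t →
          (t ≤ vmin ts) × (vmin ts ≤ vmax ts) × (vmax ts ≤ tin)
        × (Positive o → ¬ Neutral o → t < tin))

  -- Typing rules: Γ,Δ ⊢ b : (t, t_in, t_out)

  module _ (Γ : VarEnv) (Δ : OpEnv) where
    mutual
      data TyE : Expr → Tier → Tier → Tier → Set where
        ty-var : ∀ {x tin tout} → TyE (var x) (Γ x) tin tout
        ty-op  : ∀ {o es ts t tin tout} → Δ o tin ts t →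
                 TyEs es ts tin tout → TyE (op o es) t tin tout
        ty-or  : ∀ {e₁ e₂ t tin tout} →
                 TyE e₁ t tin tout → TyE e₂ tout tin tout →
                 t < tin → t ≤ tout → TyE (orc e₁ e₂) t tin tout

      data TyEs : ∀ {n} → Vec Expr n → Vec Tier n → Tier → Tier → Set where
        []  : ∀ {tin tout} → TyEs [] [] tin tout
        _∷_ : ∀ {n e t tin tout} {es : Vec Expr n} {ts : Vec Tier n} →
              TyE e t tin tout → TyEs es ts tin tout →
              TyEs (e ∷ es) (t ∷ ts) tin tout

    data TyC : Cmd → Tier → Tier → Tier → Set where
      ty-sub   : ∀ {c t tin tout} → TyC c t tin tout → TyC c (suc t) tin tout
      ty-skip  : ∀ {tin tout} → TyC skip 0 tin tout
      ty-asg   : ∀ {x e t₁ t₂ tin tout} → TyE (var x) t₁ tin tout →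
                 TyE e t₂ tin tout → t₁ ≤ t₂ → TyC (x ≔ e) t₁ tin tout
      ty-seq   : ∀ {c₁ c₂ t tin tout} → TyC c₁ t tin tout → TyC c₂ t tin tout →
                 TyC (c₁ ⨟ c₂) t tin tout
      ty-if    : ∀ {e c₁ c₀ t tin tout} → TyE e t tin tout →
                 TyC c₁ t tin tout → TyC c₀ t tin tout →
                 TyC (ifte e c₁ c₀) t tin tout
      ty-wh    : ∀ {e c t tin tout} → TyE e t tin tout → TyC c t t tout →
                 1 ≤ t → t ≤ tout → TyC (while e c) t tin tout
      ty-wh0   : ∀ {e c t tin} → TyE e t tin t → TyC c t t t →
                 1 ≤ t → TyC (while e c) t tin 0

  SafeProgram : PolyTimePred → VarEnv → OpEnv → Program → Set
  SafeProgram PT Γ Δ (c return x) =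
    SafeOpEnv PT Δ × ∃ λ t → ∃ λ tin → ∃ λ tout → TyC Γ Δ c t tin tout

  -- Stores: finite partial maps ℕ ⇀ W, as lists (index = variable)

  Store : Set
  Store = List (Maybe W)

  get : Store → Var → Maybe W
  get []      _       = nothing
  get (m ∷ s) zero    = m
  get (m ∷ s) (suc x) = get s x

  set : Store → Var → W → Store
  set []      zero    w = just w ∷ []
  set []      (suc x) w = nothing ∷ set [] x w
  set (m ∷ s) zero    w = just w ∷ s
  set (m ∷ s) (suc x) w = m ∷ set s x w

  storeSize : Store → ℕ
  storeSize []             = 0
  storeSize (nothing ∷ s)  = storeSize s
  storeSize (just w ∷ s)   = length w + storeSize s

  Oracle : Set
  Oracle = W → W

  -- Big-step semantics (derivations are elements of these families)

  module _ (φ : Oracle) where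
    mutual
      data EvalE (μ : Store) : Expr → W → Set where
        ev-var : ∀ {x w} → get μ x ≡ just w → EvalE μ (var x) w
        ev-op  : ∀ {o es ws} → EvalEs μ es ws → EvalE μ (op o es) (sem o ws)
        ev-or  : ∀ {e₁ e₂ v w} → EvalE μ e₁ v → EvalE μ e₂ w →
                 EvalE μ (orc e₁ e₂) (φ (restrict v w))

      data EvalEs (μ : Store) : ∀ {n} → Vec Expr n → Vec W n → Set where
        []  : EvalEs μ [] []
        _∷_ : ∀ {n e w} {es : Vec Expr n} {ws : Vec W n} →
              EvalE μ e w → EvalEs μ es ws → EvalEs μ (e ∷ es) (w ∷ ws)

    data EvalC : Store → Cmd → Store → Set where
      ev-skip : ∀ {μ} → EvalC μ skip μ
      ev-asg  : ∀ {μ x e w} → EvalE μ e w → EvalC μ (x ≔ e) (set μ x w)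
      ev-seq  : ∀ {μ μ₁ μ₂ c₁ c₂} → EvalC μ c₁ μ₁ → EvalC μ₁ c₂ μ₂ →
                EvalC μ (c₁ ⨟ c₂) μ₂
      ev-if1  : ∀ {μ μ' e c₁ c₀} → EvalE μ e w1 → EvalC μ c₁ μ' →
                EvalC μ (ifte e c₁ c₀) μ'
      ev-if0  : ∀ {μ μ' e c₁ c₀} → EvalE μ e w0 → EvalC μ c₀ μ' →
                EvalC μ (ifte e c₁ c₀) μ'
      ev-wh0  : ∀ {μ e c} → EvalE μ e w0 → EvalC μ (while e c) μ
      ev-wh1  : ∀ {μ μ' e c} → EvalE μ e w1 → EvalC μ (c ⨟ while e c) μ' →
                EvalC μ (while e c) μ'

    data EvalP (μ : Store) : Program → W → Set where
      ev-prog : ∀ {c x μ' w} → EvalC μ c μ' → get μ' x ≡ just w →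
                EvalP μ (c return x) w

    mutual
      sizeE : ∀ {μ e w} → EvalE μ e w → ℕ
      sizeE (ev-var _)    = 1
      sizeE (ev-op ds)    = suc (sizeEs ds)
      sizeE (ev-or d₁ d₂) = suc (sizeE d₁ + sizeE d₂)

      sizeEs : ∀ {μ n} {es : Vec Expr n} {ws} → EvalEs μ es ws → ℕ
      sizeEs []       = 0
      sizeEs (d ∷ ds) = sizeE d + sizeEs ds

    sizeC : ∀ {μ c μ'} → EvalC μ c μ' → ℕ
    sizeC ev-skip       = 1
    sizeC (ev-asg d)    = suc (sizeE d)
    sizeC (ev-seq d₁ d₂) = suc (sizeC d₁ + sizeC d₂)
    sizeC (ev-if1 d₁ d₂) = suc (sizeE d₁ + sizeC d₂)
    sizeC (ev-if0 d₁ d₂) = suc (sizeE d₁ + sizeC d₂)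
    sizeC (ev-wh0 d)    = suc (sizeE d)
    sizeC (ev-wh1 d₁ d₂) = suc (sizeE d₁ + sizeC d₂)

    sizeP : ∀ {μ p w} → EvalP μ p w → ℕ
    sizeP (ev-prog d _) = suc (sizeC d)

    mutual
      oracleMaxE : ∀ {μ e w} → EvalE μ e w → ℕ
      oracleMaxE (ev-var _) = 0
      oracleMaxE (ev-op ds) = oracleMaxEs ds
      oracleMaxE (ev-or {v = v} {w = w} d₁ d₂) =
        length (φ (restrict v w)) ⊔ (oracleMaxE d₁ ⊔ oracleMaxE d₂)

      oracleMaxEs : ∀ {μ n} {es : Vec Expr n} {ws} → EvalEs μ es ws → ℕ
      oracleMaxEs []       = 0
      oracleMaxEs (d ∷ ds) = oracleMaxE d ⊔ oracleMaxEs ds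

    oracleMaxC : ∀ {μ c μ'} → EvalC μ c μ' → ℕ
    oracleMaxC ev-skip        = 0
    oracleMaxC (ev-asg d)     = oracleMaxE d
    oracleMaxC (ev-seq d₁ d₂) = oracleMaxC d₁ ⊔ oracleMaxC d₂
    oracleMaxC (ev-if1 d₁ d₂) = oracleMaxE d₁ ⊔ oracleMaxC d₂
    oracleMaxC (ev-if0 d₁ d₂) = oracleMaxE d₁ ⊔ oracleMaxC d₂
    oracleMaxC (ev-wh0 d)     = oracleMaxE d
    oracleMaxC (ev-wh1 d₁ d₂) = oracleMaxE d₁ ⊔ oracleMaxC d₂

    oracleMaxP : ∀ {μ p w} → EvalP μ p w → ℕ
    oracleMaxP (ev-prog d _) = oracleMaxC d

    mBound : ∀ {μ p w} → EvalP μ p w → ℕ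
    mBound {μ} π = storeSize μ ⊔ oracleMaxP π

module Submission where

-- Tiers stratify the store.  A command of tier t never writes a variable of
-- higher tier, and the value of an expression of tier r depends only on the
-- variables of tier ≥ r (noninterference).  In a loop of tier t, the
-- variables of tier ≥ t only ever receive factors of their initial values, of
-- the constants of the program, 0 and 1, because oracle calls and positive
-- operators have output tiers below their input tiers.  So these variables
-- range over polynomially many configurations; the number of remaining
-- iterations is determined by the configuration and strictly decreases, so no
-- configuration repeats and the loop runs polynomially often.  A command
-- lengthens the values of tier s by at most a polynomial in the bound at
-- tier s + 1, and induction over the tiers below each loop bounds all lengths,
-- hence the size of the derivation, polynomially in the initial store size and
-- the longest oracle answer.

open import Defs
open import Data.Nat using (ℕ; zero; suc; _+_; _*_; _^_; _≤_; _<_; _⊔_; z≤n; s≤s; _≤?_; _<?_; _≟_)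
open import Data.Nat.Properties
open import Data.Product using (∃; _×_; _,_; proj₁; proj₂)
open import Data.Sum using (_⊎_; inj₁; inj₂)
open import Data.List using (List; []; _∷_; _++_; length; map; concatMap; filter; catMaybes)
open import Data.List.Properties using (length-++; length-map; ++-assoc; ++-identityʳ; ≡-dec; ∷-injectiveˡ; ∷-injectiveʳ; length-catMaybes)
open import Data.List.Membership.Propositional using (_∈_; _∉_; find; lose)
open import Data.List.Membership.Propositional.Properties
  using (∈-++⁺ˡ; ∈-++⁺ʳ; ∈-++⁻; ∈-map⁺; ∈-map⁻; ∈-∃++; ∈-concatMap⁺; ∈-concatMap⁻; ∈-filter⁺; ∈-filter⁻)
open import Data.List.Membership.DecPropositional _≟_ using () renaming (_∈?_ to _∈ℕ?_)
open import Data.List.Relation.Unary.Any using (here; there)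
open import Data.List.Relation.Unary.All using (All; []; _∷_)
import Data.List.Relation.Unary.All as All
import Data.List.Relation.Unary.All.Properties as All
open import Data.List.Relation.Unary.AllPairs using (AllPairs; []; _∷_)
open import Data.Empty using (⊥-elim)
open import Function using (_∘_; case_of_)
open import Data.Maybe using (Maybe; just; nothing)
open import Data.Maybe.Properties using (just-injective)
open import Data.Vec using (Vec; []; _∷_)
import Data.Vec as V
open import Data.Vec.Relation.Unary.All using ([]; _∷_) renaming (All to AllV)
import Data.Vec.Relation.Unary.All as AllV
import Data.Vec.Relation.Unary.All.Properties as AllV
open import Data.Fin using (Fin)
import Data.Fin.Properties as Fin
open import Data.Unit using (⊤; tt)
open import Relation.Nullary using (¬_; Dec; yes; no)
open import Relation.Nullary.Decidable using (decidable-stable)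
open import Relation.Binary.PropositionalEquality
  using (_≡_; _≢_; refl; sym; trans; cong; cong₂; subst; module ≡-Reasoning)
open import Algebra.Properties.CommutativeSemigroup +-commutativeSemigroup
  using () renaming (interchange to +-interchange)
open import Algebra.Properties.CommutativeSemigroup *-commutativeSemigroup
  using () renaming (x∙yz≈y∙xz to *-left-comm)

-- (a , d) stands for x ↦ a (1 + x)ᵈ; such functions are closed, up to ≤,
-- under sum, product and composition.
Mono : Set
Mono = ℕ × ℕ

⟦_⟧ : Mono → ℕ → ℕ
⟦ a , d ⟧ x = a * suc x ^ d

⟦⟧-mono : ∀ p {x y} → x ≤ y → ⟦ p ⟧ x ≤ ⟦ p ⟧ y
⟦⟧-mono (a , d) x≤y = *-monoʳ-≤ a (^-monoˡ-≤ d (s≤s x≤y))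

constM : ℕ → Mono
constM c = c , 0

idM : Mono
idM = 1 , 1

_⊕_ : Mono → Mono → Mono
(a , d) ⊕ (b , e) = a + b , d ⊔ e

_⊗_ : Mono → Mono → Mono
(a , d) ⊗ (b , e) = a * b , d + e

_⊙_ : Mono → Mono → Mono
(a , d) ⊙ (b , e) = a * suc b ^ d , e * d

powM : Mono → ℕ → Mono
powM p zero    = constM 1
powM p (suc n) = p ⊗ powM p n

⟦constM⟧ : ∀ c x → c ≤ ⟦ constM c ⟧ x
⟦constM⟧ c x = ≤-reflexive (sym (*-identityʳ c))

⟦idM⟧ : ∀ x → x ≤ ⟦ idM ⟧ x
⟦idM⟧ x = ≤-trans (n≤1+n x) (≤-reflexive (sym (trans (*-identityˡ _) (*-identityʳ _))))

⟦⊕⟧ : ∀ p q x → ⟦ p ⟧ x + ⟦ q ⟧ x ≤ ⟦ p ⊕ q ⟧ x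
⟦⊕⟧ (a , d) (b , e) x = begin
  a * suc x ^ d + b * suc x ^ e
    ≤⟨ +-mono-≤ (*-monoʳ-≤ a (^-monoʳ-≤ (suc x) (m≤m⊔n d e)))
                (*-monoʳ-≤ b (^-monoʳ-≤ (suc x) (m≤n⊔m d e))) ⟩
  a * suc x ^ (d ⊔ e) + b * suc x ^ (d ⊔ e)
    ≡⟨ *-distribʳ-+ (suc x ^ (d ⊔ e)) a b ⟨
  (a + b) * suc x ^ (d ⊔ e) ∎
  where open ≤-Reasoning

⟦⊕⟧ˡ : ∀ p q x → ⟦ p ⟧ x ≤ ⟦ p ⊕ q ⟧ x
⟦⊕⟧ˡ p q x = ≤-trans (m≤m+n _ _) (⟦⊕⟧ p q x)

⟦⊕⟧ʳ : ∀ p q x → ⟦ q ⟧ x ≤ ⟦ p ⊕ q ⟧ x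
⟦⊕⟧ʳ p q x = ≤-trans (m≤n+m _ _) (⟦⊕⟧ p q x)

⟦⊗⟧ : ∀ p q x → ⟦ p ⟧ x * ⟦ q ⟧ x ≤ ⟦ p ⊗ q ⟧ x
⟦⊗⟧ (a , d) (b , e) x = ≤-reflexive (begin
  a * suc x ^ d * (b * suc x ^ e)    ≡⟨ [m*n]*[o*p]≡[m*o]*[n*p] a _ b _ ⟩
  a * b * (suc x ^ d * suc x ^ e)    ≡⟨ cong (a * b *_) (^-distribˡ-+-* (suc x) d e) ⟨
  a * b * suc x ^ (d + e)            ∎)
  where open ≡-Reasoning

^-distribʳ-* : ∀ m n d → (m * n) ^ d ≡ m ^ d * n ^ d
^-distribʳ-* m n zero    = refl
^-distribʳ-* m n (suc d) =
  trans (cong (m * n *_) (^-distribʳ-* m n d)) ([m*n]*[o*p]≡[m*o]*[n*p] m n _ _)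

⟦⊙⟧ : ∀ p q x → ⟦ p ⟧ (⟦ q ⟧ x) ≤ ⟦ p ⊙ q ⟧ x
⟦⊙⟧ (a , d) (b , e) x = begin
  a * suc (b * suc x ^ e) ^ d
    ≤⟨ *-monoʳ-≤ a (^-monoˡ-≤ d (+-monoˡ-≤ (b * suc x ^ e) (m^n>0 (suc x) e))) ⟩
  a * (suc b * suc x ^ e) ^ d
    ≡⟨ cong (a *_) (^-distribʳ-* (suc b) (suc x ^ e) d) ⟩
  a * (suc b ^ d * (suc x ^ e) ^ d)
    ≡⟨ *-assoc a _ _ ⟨
  a * suc b ^ d * (suc x ^ e) ^ d
    ≡⟨ cong (a * suc b ^ d *_) (^-*-assoc (suc x) e d) ⟩
  a * suc b ^ d * suc x ^ (e * d) ∎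
  where open ≤-Reasoning

⟦⊙⟧-shift : ∀ p q x → ⟦ p ⟧ (x + ⟦ q ⟧ x) ≤ ⟦ p ⊙ (idM ⊕ q) ⟧ x
⟦⊙⟧-shift p q x = ≤-trans (⟦⟧-mono p (≤-trans (+-monoˡ-≤ _ (⟦idM⟧ x)) (⟦⊕⟧ idM q x))) (⟦⊙⟧ p (idM ⊕ q) x)

⟦powM⟧ : ∀ p n x → ⟦ p ⟧ x ^ n ≤ ⟦ powM p n ⟧ x
⟦powM⟧ p zero    x = ⟦constM⟧ 1 x
⟦powM⟧ p (suc n) x = ≤-trans (*-monoʳ-≤ (⟦ p ⟧ x) (⟦powM⟧ p n x)) (⟦⊗⟧ p (powM p n) x)

addPoly : Poly → Poly → Poly
addPoly []      q       = q
addPoly (a ∷ p) []      = a ∷ p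
addPoly (a ∷ p) (b ∷ q) = a + b ∷ addPoly p q

evalPoly-addPoly : ∀ p q x → evalPoly (addPoly p q) x ≡ evalPoly p x + evalPoly q x
evalPoly-addPoly []      q       x = refl
evalPoly-addPoly (a ∷ p) []      x = sym (+-identityʳ _)
evalPoly-addPoly (a ∷ p) (b ∷ q) x = begin
  a + b + x * evalPoly (addPoly p q) x        ≡⟨ cong (λ r → a + b + x * r) (evalPoly-addPoly p q x) ⟩
  a + b + x * (evalPoly p x + evalPoly q x)   ≡⟨ cong (a + b +_) (*-distribˡ-+ x _ _) ⟩
  a + b + (x * evalPoly p x + x * evalPoly q x) ≡⟨ +-interchange a b _ _ ⟩
  a + x * evalPoly p x + (b + x * evalPoly q x) ∎
  where open ≡-Reasoning

scalePoly : ℕ → Poly → Poly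
scalePoly a = map (a *_)

evalPoly-scalePoly : ∀ a p x → evalPoly (scalePoly a p) x ≡ a * evalPoly p x
evalPoly-scalePoly a []      x = sym (*-zeroʳ a)
evalPoly-scalePoly a (b ∷ p) x = begin
  a * b + x * evalPoly (scalePoly a p) x ≡⟨ cong (λ r → a * b + x * r) (evalPoly-scalePoly a p x) ⟩
  a * b + x * (a * evalPoly p x)         ≡⟨ cong (a * b +_) (*-left-comm x a _) ⟩
  a * b + a * (x * evalPoly p x)         ≡⟨ *-distribˡ-+ a b _ ⟨
  a * (b + x * evalPoly p x)             ∎
  where open ≡-Reasoning

binomialPoly : ℕ → Poly
binomialPoly zero    = 1 ∷ []
binomialPoly (suc d) = addPoly (binomialPoly d) (0 ∷ binomialPoly d)

evalPoly-binomialPoly : ∀ d x → evalPoly (binomialPoly d) x ≡ suc x ^ d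
evalPoly-binomialPoly zero    x = cong suc (*-zeroʳ x)
evalPoly-binomialPoly (suc d) x
  rewrite evalPoly-addPoly (binomialPoly d) (0 ∷ binomialPoly d) x
        | evalPoly-binomialPoly d x = refl

toPoly : Mono → Poly
toPoly (a , d) = scalePoly a (binomialPoly d)

evalPoly-toPoly : ∀ p x → evalPoly (toPoly p) x ≡ ⟦ p ⟧ x
evalPoly-toPoly (a , d) x
  rewrite evalPoly-scalePoly a (binomialPoly d) x | evalPoly-binomialPoly d x = refl

module _ {A : Set} where

  ∈-remove : ∀ {x z : A} ys zs → z ∈ ys ++ x ∷ zs → z ≢ x → z ∈ ys ++ zs
  ∈-remove ys zs z∈ z≢x with ∈-++⁻ ys z∈
  ... | inj₁ p          = ∈-++⁺ˡ p
  ... | inj₂ (here z≡x) = ⊥-elim (z≢x z≡x)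
  ... | inj₂ (there p)  = ∈-++⁺ʳ ys p

  distinct⊆⇒length≤ : ∀ (xs U : List A) → AllPairs _≢_ xs → All (_∈ U) xs → length xs ≤ length U
  distinct⊆⇒length≤ []       U _                  _            = z≤n
  distinct⊆⇒length≤ (x ∷ xs) U (x≢xs ∷ distinct) (x∈U ∷ xs⊆U) with ∈-∃++ x∈U
  ... | ys , zs , refl = begin
    suc (length xs)                   ≤⟨ s≤s (distinct⊆⇒length≤ xs (ys ++ zs) distinct xs⊆ys++zs) ⟩
    suc (length (ys ++ zs))           ≡⟨ cong suc (length-++ ys) ⟩
    suc (length ys + length zs)       ≡⟨ +-suc (length ys) (length zs) ⟨
    length ys + length (x ∷ zs)       ≡⟨ length-++ ys ⟨
    length (ys ++ x ∷ zs)             ∎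
    where
    open ≤-Reasoning
    xs⊆ys++zs : All (_∈ ys ++ zs) xs
    xs⊆ys++zs = All.zipWith (λ (z≢x , z∈) → ∈-remove ys zs z∈ (λ z≡x → z≢x (sym z≡x))) (x≢xs , xs⊆U)

  length-concatMap≤ : ∀ {B : Set} (f : A → List B) n xs →
                      All (λ x → length (f x) ≤ n) xs → length (concatMap f xs) ≤ length xs * n
  length-concatMap≤ f n []       []             = z≤n
  length-concatMap≤ f n (x ∷ xs) (fx≤n ∷ fxs≤n) = begin
    length (f x ++ concatMap f xs)        ≡⟨ length-++ (f x) ⟩
    length (f x) + length (concatMap f xs) ≤⟨ +-mono-≤ fx≤n (length-concatMap≤ f n xs fxs≤n) ⟩
    n + length xs * n                     ∎
    where open ≤-Reasoning

  map≡⇒pointwise : ∀ {B : Set} {f g : A → B} {x} xs → map f xs ≡ map g xs → x ∈ xs → f x ≡ g x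
  map≡⇒pointwise (x ∷ xs) eq (here refl) = ∷-injectiveˡ eq
  map≡⇒pointwise (x ∷ xs) eq (there x∈)  = map≡⇒pointwise xs (∷-injectiveʳ eq) x∈

  ∈-concatMap⁺′ : ∀ {B : Set} (f : A → List B) {x xs y} → y ∈ f x → x ∈ xs → y ∈ concatMap f xs
  ∈-concatMap⁺′ f y∈fx x∈xs = ∈-concatMap⁺ f (lose x∈xs y∈fx)

  ∈-concatMap⁻′ : ∀ {B : Set} (f : A → List B) {xs y} → y ∈ concatMap f xs → ∃ λ x → x ∈ xs × y ∈ f x
  ∈-concatMap⁻′ f y∈ = find (∈-concatMap⁻ f y∈)

  totalLength : List (List A) → ℕ
  totalLength []         = 0
  totalLength (xs ∷ xss) = length xs + totalLength xss

  length≤totalLength : ∀ xss → All (λ xs → length xs ≤ totalLength xss) xss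
  length≤totalLength []         = []
  length≤totalLength (xs ∷ xss) =
    m≤m+n (length xs) _ ∷ All.map (λ ≤total → ≤-trans ≤total (m≤n+m _ (length xs))) (length≤totalLength xss)

  listsOver : ℕ → List A → List (List A)
  listsOver zero    U = [] ∷ []
  listsOver (suc n) U = concatMap (λ a → map (a ∷_) (listsOver n U)) U

  ∈-listsOver : ∀ {U} (xs : List A) → All (_∈ U) xs → xs ∈ listsOver (length xs) U
  ∈-listsOver []       []           = here refl
  ∈-listsOver (x ∷ xs) (x∈U ∷ xs⊆U) =
    ∈-concatMap⁺′ (λ a → map (a ∷_) (listsOver (length xs) _)) (∈-map⁺ (x ∷_) (∈-listsOver xs xs⊆U)) x∈U

  length-listsOver : ∀ n U → length (listsOver n U) ≤ length U ^ n
  length-listsOver zero    U = ≤-refl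
  length-listsOver (suc n) U = length-concatMap≤ _ (length U ^ n) U
    (All.tabulate λ {a} _ → ≤-trans (≤-reflexive (length-map (a ∷_) (listsOver n U))) (length-listsOver n U))

  prefixes : List A → List (List A)
  prefixes []      = [] ∷ []
  prefixes (a ∷ w) = [] ∷ map (a ∷_) (prefixes w)

  ∈-prefixes⁺ : ∀ v u → v ∈ prefixes (v ++ u)
  ∈-prefixes⁺ []      []      = here refl
  ∈-prefixes⁺ []      (a ∷ u) = here refl
  ∈-prefixes⁺ (a ∷ v) u       = there (∈-map⁺ (a ∷_) (∈-prefixes⁺ v u))

  ∈-prefixes⁻ : ∀ {v} w → v ∈ prefixes w → ∃ λ u → w ≡ v ++ u
  ∈-prefixes⁻ []      (here refl) = [] , refl
  ∈-prefixes⁻ (a ∷ w) (here refl) = a ∷ w , refl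
  ∈-prefixes⁻ (a ∷ w) (there v∈)  with ∈-map⁻ (a ∷_) v∈
  ... | v′ , v′∈ , refl with ∈-prefixes⁻ w v′∈
  ... | u , w≡v′++u = u , cong (a ∷_) w≡v′++u

  length-prefixes : ∀ w → length (prefixes w) ≡ suc (length w)
  length-prefixes []      = refl
  length-prefixes (a ∷ w) = cong suc (trans (length-map (a ∷_) (prefixes w)) (length-prefixes w))

  factors : List A → List (List A)
  factors []      = prefixes []
  factors (a ∷ w) = prefixes (a ∷ w) ++ factors w

  length-factors : ∀ w → length (factors w) ≤ suc (length w) * suc (length w)
  length-factors []      = ≤-refl
  length-factors (a ∷ w) = begin
    length (prefixes (a ∷ w) ++ factors w)           ≡⟨ length-++ (prefixes (a ∷ w)) ⟩
    length (prefixes (a ∷ w)) + length (factors w)   ≤⟨ +-mono-≤ (≤-reflexive (length-prefixes (a ∷ w))) (length-factors w) ⟩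
    suc (suc n) + suc n * suc n                      ≤⟨ +-monoʳ-≤ (suc (suc n)) (*-monoʳ-≤ (suc n) (n≤1+n (suc n))) ⟩
    suc (suc n) * suc (suc n)                        ∎
    where
    open ≤-Reasoning
    n : ℕ
    n = length w

module _ {k : ℕ} where

  ⊴-refl : (w : Word k) → w ⊴ w
  ⊴-refl w = [] , [] , sym (++-identityʳ w)

  ⊴-trans : {u v w : Word k} → u ⊴ v → v ⊴ w → u ⊴ w
  ⊴-trans {u} (p , p′ , refl) (q , q′ , refl) = q ++ p , p′ ++ q′ , (begin
    q ++ ((p ++ (u ++ p′)) ++ q′)  ≡⟨ cong (q ++_) (trans (++-assoc p _ q′) (cong (p ++_) (++-assoc u p′ q′))) ⟩
    q ++ (p ++ (u ++ (p′ ++ q′)))  ≡⟨ ++-assoc q p _ ⟨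
    (q ++ p) ++ (u ++ (p′ ++ q′))  ∎)
    where open ≡-Reasoning

  ⊴-length : {v w : Word k} → v ⊴ w → length v ≤ length w
  ⊴-length {v} (u , u′ , refl) = begin
    length v                       ≤⟨ m≤m+n (length v) (length u′) ⟩
    length v + length u′           ≡⟨ length-++ v ⟨
    length (v ++ u′)               ≤⟨ m≤n+m _ (length u) ⟩
    length u + length (v ++ u′)    ≡⟨ length-++ u ⟨
    length (u ++ (v ++ u′))        ∎
    where open ≤-Reasoning

  ∈-factors⁺ : {v w : Word k} → v ⊴ w → v ∈ factors w
  ∈-factors⁺ {v} ([]    , u′ , refl) = prefixes⊆factors (v ++ u′) (∈-prefixes⁺ v u′)
    where
    prefixes⊆factors : ∀ w → v ∈ prefixes w → v ∈ factors w
    prefixes⊆factors []      v∈ = v∈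
    prefixes⊆factors (a ∷ w) v∈ = ∈-++⁺ˡ v∈
  ∈-factors⁺ {v} (a ∷ u , u′ , refl) = ∈-++⁺ʳ (prefixes (a ∷ u ++ v ++ u′)) (∈-factors⁺ (u , u′ , refl))

  ∈-factors⁻ : {v : Word k} (w : Word k) → v ∈ factors w → v ⊴ w
  ∈-factors⁻ []      v∈ = let u , eq = ∈-prefixes⁻ [] v∈ in [] , u , eq
  ∈-factors⁻ (a ∷ w) v∈ with ∈-++⁻ (prefixes (a ∷ w)) v∈
  ... | inj₁ p = let u , eq = ∈-prefixes⁻ (a ∷ w) p in [] , u , eq
  ... | inj₂ p = let u , u′ , eq = ∈-factors⁻ w p in a ∷ u , u′ , cong (a ∷_) eq

module _ {A : Set} where

  ∈-catMaybes⁺ : ∀ {a : A} ms → just a ∈ ms → a ∈ catMaybes ms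
  ∈-catMaybes⁺ (nothing ∷ ms) (there p)   = ∈-catMaybes⁺ ms p
  ∈-catMaybes⁺ (just _ ∷ ms)  (here refl) = here refl
  ∈-catMaybes⁺ (just _ ∷ ms)  (there p)   = there (∈-catMaybes⁺ ms p)

  ∈-catMaybes⁻ : ∀ {a : A} ms → a ∈ catMaybes ms → just a ∈ ms
  ∈-catMaybes⁻ (nothing ∷ ms) p           = there (∈-catMaybes⁻ ms p)
  ∈-catMaybes⁻ (just _ ∷ ms)  (here refl) = here refl
  ∈-catMaybes⁻ (just _ ∷ ms)  (there p)   = there (∈-catMaybes⁻ ms p)

module _ (S : Signature) where
  open Signature S

  varsE : Expr S → List Var
  varsEs : ∀ {n} → Vec (Expr S) n → List Var
  varsE (var x)    = x ∷ []
  varsE (op o es)  = varsEs es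
  varsE (orc a b)  = varsE a ++ varsE b
  varsEs []        = []
  varsEs (e ∷ es)  = varsE e ++ varsEs es

  varsC : Cmd S → List Var
  varsC skip         = []
  varsC (x ≔ e)      = x ∷ varsE e
  varsC (c ⨟ d)      = varsC c ++ varsC d
  varsC (ifte e c d) = varsE e ++ (varsC c ++ varsC d)
  varsC (while e c)  = varsE e ++ varsC c

  nullaryValue : ∀ n → (Vec (W S) n → W S) → List (W S)
  nullaryValue zero    f = f [] ∷ []
  nullaryValue (suc n) f = []

  ∈-nullaryValue : ∀ n (f : Vec (W S) n → W S) ws → ¬ (0 < n) → f ws ∈ nullaryValue n f
  ∈-nullaryValue zero    f [] _   = here refl
  ∈-nullaryValue (suc n) f ws 0≮n = ⊥-elim (0≮n (s≤s z≤n))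

  constsE : Expr S → List (W S)
  constsEs : ∀ {n} → Vec (Expr S) n → List (W S)
  constsE (var x)   = []
  constsE (op o es) = nullaryValue (ar o) (sem o) ++ constsEs es
  constsE (orc a b) = constsE a ++ constsE b
  constsEs []       = []
  constsEs (e ∷ es) = constsE e ++ constsEs es

  constsC : Cmd S → List (W S)
  constsC skip         = []
  constsC (x ≔ e)      = constsE e
  constsC (c ⨟ d)      = constsC c ++ constsC d
  constsC (ifte e c d) = constsE e ++ (constsC c ++ constsC d)
  constsC (while e c)  = constsE e ++ constsC c

  sizeExpr : Expr S → ℕ
  sizeExprs : ∀ {n} → Vec (Expr S) n → ℕ
  sizeExpr (var x)   = 1
  sizeExpr (op o es) = suc (sizeExprs es)
  sizeExpr (orc a b) = suc (sizeExpr a + sizeExpr b)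
  sizeExprs []       = 0
  sizeExprs (e ∷ es) = sizeExpr e + sizeExprs es

  get-set-≡ : ∀ (μ : Store S) x w → get S (set S μ x w) x ≡ just w
  get-set-≡ []      zero    w = refl
  get-set-≡ []      (suc x) w = get-set-≡ [] x w
  get-set-≡ (m ∷ μ) zero    w = refl
  get-set-≡ (m ∷ μ) (suc x) w = get-set-≡ μ x w

  get-[] : ∀ y → get S [] y ≡ nothing
  get-[] zero    = refl
  get-[] (suc y) = refl

  get-set-≢ : ∀ (μ : Store S) x y w → y ≢ x → get S (set S μ x w) y ≡ get S μ y
  get-set-≢ []      zero    zero    w y≢x = ⊥-elim (y≢x refl)
  get-set-≢ []      zero    (suc y) w y≢x = get-[] y
  get-set-≢ []      (suc x) zero    w y≢x = refl
  get-set-≢ []      (suc x) (suc y) w y≢x = get-set-≢ [] x y w (λ eq → y≢x (cong suc eq))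
  get-set-≢ (m ∷ μ) zero    zero    w y≢x = ⊥-elim (y≢x refl)
  get-set-≢ (m ∷ μ) zero    (suc y) w y≢x = refl
  get-set-≢ (m ∷ μ) (suc x) zero    w y≢x = refl
  get-set-≢ (m ∷ μ) (suc x) (suc y) w y≢x = get-set-≢ μ x y w (λ eq → y≢x (cong suc eq))

  get≤storeSize : ∀ (μ : Store S) x {w} → get S μ x ≡ just w → length w ≤ storeSize S μ
  get≤storeSize (nothing ∷ μ) zero    ()
  get≤storeSize (just w ∷ μ)  zero    refl = m≤m+n _ _
  get≤storeSize (nothing ∷ μ) (suc x) eq   = get≤storeSize μ x eq
  get≤storeSize (just w ∷ μ)  (suc x) eq   = ≤-trans (get≤storeSize μ x eq) (m≤n+m _ _)

module Safe (S : Signature) (PT : PolyTimePred S) (Γ : VarEnv S) (Δ : OpEnv S)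
            (safe : SafeOpEnv S PT Δ) where
  open Signature S

  ⊢E : Expr S → Tier → Tier → Tier → Set
  ⊢E = TyE S Γ Δ

  ⊢Es : ∀ {n} → Vec (Expr S) n → Vec Tier n → Tier → Tier → Set
  ⊢Es = TyEs S Γ Δ

  ⊢C : Cmd S → Tier → Tier → Tier → Set
  ⊢C = TyC S Γ Δ

  record Holds (s : Tier) (Q : Var → Set) (P : W S → Set) (μ : Store S) : Set where
    constructor mkHolds
    field holds : ∀ y {w} → Q y → s ≤ Γ y → get S μ y ≡ just w → P w
  open Holds public

  Holds-anti : ∀ {s s′ Q P μ} → s ≤ s′ → Holds s Q P μ → Holds s′ Q P μ
  Holds-anti s≤s′ h = mkHolds λ y q le eq → holds h y q (≤-trans s≤s′ le) eq

  Bounded : Tier → ℕ → Store S → Set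
  Bounded s X = Holds s (λ _ → ⊤) (λ w → length w ≤ X)

  Bounded-mono : ∀ {s X X′ μ} → X ≤ X′ → Bounded s X μ → Bounded s X′ μ
  Bounded-mono X≤X′ h = mkHolds λ y q le eq → ≤-trans (holds h y q le eq) X≤X′

  record Agree (s : Tier) (μ ν : Store S) : Set where
    constructor mkAgree
    field agree : ∀ y → s ≤ Γ y → get S μ y ≡ get S ν y
  open Agree public

  Agree-anti : ∀ {s s′ μ ν} → s ≤ s′ → Agree s μ ν → Agree s′ μ ν
  Agree-anti s≤s′ a = mkAgree λ y le → agree a y (≤-trans s≤s′ le)

  record NeutralClosed (P : W S → Set) : Set where
    field
      ⊴-closed : ∀ {u v} → v ⊴ u → P u → P v
      ∋w0      : P w0
      ∋w1      : P w1
      -- lets safety refute positive non-neutral operators constructively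
      decide   : ∀ w → Dec (P w)
  open NeutralClosed public

  neutral-closed : ∀ {P o ws} → NeutralClosed P → Neutral S o → 0 < ar o → AllV P ws → P (sem o ws)
  neutral-closed     cl (inj₁ ar≡0) 0<ar _ = ⊥-elim (<-irrefl (sym ar≡0) 0<ar)
  neutral-closed {P} {ws = ws} cl (inj₂ (inj₁ boolean)) _ _ with boolean ws
  ... | inj₁ ≡w0 = subst P (sym ≡w0) (∋w0 cl)
  ... | inj₂ ≡w1 = subst P (sym ≡w1) (∋w1 cl)
  neutral-closed {ws = ws} cl (inj₂ (inj₂ factor)) _ Pws =
    let i , sem⊴ = factor ws in ⊴-closed cl sem⊴ (AllV.lookup⁺ Pws i)

  length≤-closed : ∀ {Y} → 1 ≤ Y → NeutralClosed (λ w → length w ≤ Y)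
  length≤-closed {Y} 1≤Y = record
    { ⊴-closed = λ v⊴u |u|≤Y → ≤-trans (⊴-length v⊴u) |u|≤Y
    ; ∋w0      = 1≤Y
    ; ∋w1      = 1≤Y
    ; decide   = λ w → length w ≤? Y
    }

  ≤vmin⇒All≤ : ∀ {t n} (ts : Vec ℕ n) → 0 < n → t ≤ vmin ts → AllV (t ≤_) ts
  ≤vmin⇒All≤ (x ∷ [])     _ le = le ∷ []
  ≤vmin⇒All≤ (x ∷ y ∷ xs) _ le = m≤n⊓o⇒m≤n x _ le ∷ ≤vmin⇒All≤ (y ∷ xs) (s≤s z≤n) (m≤n⊓o⇒m≤o x _ le)

  All≤⇒vmax≤ : ∀ {n Y} (ws : Vec (W S) n) → AllV (λ w → length w ≤ Y) ws → vmax (V.map length ws) ≤ Y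
  All≤⇒vmax≤ []       []         = z≤n
  All≤⇒vmax≤ (w ∷ ws) (p ∷ ps) = ⊔-lub p (All≤⇒vmax≤ ws ps)

  neutralOrPositive : ∀ {o tin ts t} → Δ o tin ts t → 0 < ar o → Neutral S o ⊎ Positive S o
  neutralOrPositive {o} {tin} {ts} {t} δ 0<ar = proj₁ (safe o 0<ar (tin , ts , t , δ))

  result≤args : ∀ {o tin ts t} → Δ o tin ts t → 0 < ar o → t ≤ vmin ts
  result≤args {o} {tin} {ts} {t} δ 0<ar = proj₁ (proj₂ (proj₂ (safe o 0<ar (tin , ts , t , δ))) tin ts t δ)

  positive⇒result<input : ∀ {o tin ts t} → Δ o tin ts t → 0 < ar o → Positive S o → ¬ Neutral S o → t < tin
  positive⇒result<input {o} {tin} {ts} {t} δ 0<ar =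
    proj₂ (proj₂ (proj₂ (proj₂ (proj₂ (safe o 0<ar (tin , ts , t , δ))) tin ts t δ)))

  argTiers≥ : ∀ {o tin ts t} → Δ o tin ts t → AllV (t ≤_) ts
  argTiers≥ {o} {ts = ts} δ with 0 <? ar o
  ... | yes 0<ar = ≤vmin⇒All≤ ts 0<ar (result≤args δ 0<ar)
  ... | no 0≮ar  = AllV.lookup⁻ λ i → ⊥-elim (0≮ar (≤-<-trans z≤n (Fin.toℕ<n i)))

  ¬¬neutral : ∀ {o tin ts t} → Δ o tin ts t → 0 < ar o → tin ≤ t → ¬ ¬ Neutral S o
  ¬¬neutral δ 0<ar tin≤t ¬neutral with neutralOrPositive δ 0<ar
  ... | inj₁ neutral  = ¬neutral neutral
  ... | inj₂ positive = <-irrefl refl (<-≤-trans (positive⇒result<input δ 0<ar positive ¬neutral) tin≤t)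

  op-closed : ∀ {P o tin ts t ws} → NeutralClosed P → Δ o tin ts t → tin ≤ t →
              AllV P ws → All P (nullaryValue S (ar o) (sem o)) → P (sem o ws)
  op-closed {o = o} {ws = ws} cl δ tin≤t Pws Pconsts with 0 <? ar o
  ... | no 0≮ar  = All.lookup Pconsts (∈-nullaryValue S (ar o) (sem o) ws 0≮ar)
  ... | yes 0<ar = decidable-stable (decide cl (sem o ws))
                     λ ¬P → ¬¬neutral δ 0<ar tin≤t (λ neutral → ¬P (neutral-closed cl neutral 0<ar Pws))

  op-affine : ∀ {o tin ts t} → Δ o tin ts t → ∃ λ c → ∀ ws {Y} → 1 ≤ Y →
              AllV (λ w → length w ≤ Y) ws → All (λ w → length w ≤ Y) (nullaryValue S (ar o) (sem o)) →
              length (sem o ws) ≤ Y + c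
  op-affine {o} {tin} {ts} {t} δ with 0 <? ar o
  ... | no 0≮ar = 0 , λ ws {Y} _ _ consts≤ →
    ≤-trans (All.lookup consts≤ (∈-nullaryValue S (ar o) (sem o) ws 0≮ar)) (m≤m+n Y 0)
  ... | yes 0<ar with neutralOrPositive δ 0<ar
  ... | inj₁ neutral = 0 , λ ws {Y} 1≤Y ws≤ _ →
    ≤-trans (neutral-closed (length≤-closed 1≤Y) neutral 0<ar ws≤) (m≤m+n Y 0)
  ... | inj₂ (c , positive) = c , λ ws _ ws≤ _ → ≤-trans (positive ws) (+-monoˡ-≤ c (All≤⇒vmax≤ ws ws≤))

  growthE : ∀ {e r tin tout} → ⊢E e r tin tout → ℕ
  growthEs : ∀ {n} {es : Vec (Expr S) n} {ts tin tout} → ⊢Es es ts tin tout → ℕ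
  growthE ty-var           = 0
  growthE (ty-op δ tys)    = growthEs tys + proj₁ (op-affine δ)
  growthE (ty-or _ _ _ _)  = 0
  growthEs []              = 0
  growthEs (ty ∷ tys)      = growthE ty + growthEs tys

  module Run (φ : Oracle S) where
    ⇓E : Store S → Expr S → W S → Set
    ⇓E = EvalE S φ

    ⇓Es : Store S → ∀ {n} → Vec (Expr S) n → Vec (W S) n → Set
    ⇓Es = EvalEs S φ

    ⇓C : Store S → Cmd S → Store S → Set
    ⇓C = EvalC S φ

    private variable
      e : Expr S
      c : Cmd S
      n : ℕ
      es : Vec (Expr S) n
      ts : Vec Tier n
      w w′ : W S
      ws ws′ : Vec (W S) n
      μ μ′ ν ν′ : Store S
      r s t tc tin tout tout′ : Tier

    w1≢w0 : w1 {k} ≢ w0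
    w1≢w0 ()

    noninterferenceE : ⊢E e r tin tout → ⇓E μ e w → ⇓E ν e w′ → Agree r μ ν → w ≡ w′
    noninterferenceEs : ⊢Es es ts tin tout → ⇓Es μ es ws → ⇓Es ν es ws′ →
                        AllV (r ≤_) ts → Agree r μ ν → ws ≡ ws′
    noninterferenceE {e = var x} ty-var (ev-var μx) (ev-var νx) a =
      just-injective (trans (sym μx) (trans (agree a x ≤-refl) νx))
    noninterferenceE (ty-op {o = o} δ tys) (ev-op ds) (ev-op ds′) a =
      cong (sem o) (noninterferenceEs tys ds ds′ (argTiers≥ δ) a)
    noninterferenceE (ty-or ty₁ ty₂ _ r≤tout) (ev-or d₁ d₂) (ev-or d₁′ d₂′) a =
      cong₂ (λ v w → φ (restrict v w))
        (noninterferenceE ty₁ d₁ d₁′ a) (noninterferenceE ty₂ d₂ d₂′ (Agree-anti r≤tout a))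
    noninterferenceEs [] [] [] _ _ = refl
    noninterferenceEs (ty ∷ tys) (d ∷ ds) (d′ ∷ ds′) (r≤t ∷ r≤ts) a =
      cong₂ _∷_ (noninterferenceE ty d d′ (Agree-anti r≤t a)) (noninterferenceEs tys ds ds′ r≤ts a)

    iterations : ⇓C μ (while e c) μ′ → ℕ
    iterations (ev-wh0 _)                = 0
    iterations (ev-wh1 _ (ev-seq _ rest)) = suc (iterations rest)

    higherTiers-unchanged : ⊢C c tc tin tout → ⇓C μ c μ′ → ∀ y → tc < Γ y → get S μ′ y ≡ get S μ y
    higherTiers-unchanged (ty-sub ty) d y lt = higherTiers-unchanged ty d y (<⇒≤ lt)
    higherTiers-unchanged ty-skip ev-skip y lt = refl
    higherTiers-unchanged {μ = μ} (ty-asg {x = x} ty-var _ _) (ev-asg {w = w} _) y lt =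
      get-set-≢ S μ x y w (λ y≡x → <-irrefl (cong Γ (sym y≡x)) lt)
    higherTiers-unchanged (ty-seq ty₁ ty₂) (ev-seq d₁ d₂) y lt =
      trans (higherTiers-unchanged ty₂ d₂ y lt) (higherTiers-unchanged ty₁ d₁ y lt)
    higherTiers-unchanged (ty-if _ ty₁ _) (ev-if1 _ d) y lt = higherTiers-unchanged ty₁ d y lt
    higherTiers-unchanged (ty-if _ _ ty₀) (ev-if0 _ d) y lt = higherTiers-unchanged ty₀ d y lt
    higherTiers-unchanged (ty-wh _ _ _ _) (ev-wh0 _) y lt = refl
    higherTiers-unchanged ty@(ty-wh _ tyc _ _) (ev-wh1 _ (ev-seq d rest)) y lt =
      trans (higherTiers-unchanged ty rest y lt) (higherTiers-unchanged tyc d y lt)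
    higherTiers-unchanged (ty-wh0 _ _ _) (ev-wh0 _) y lt = refl
    higherTiers-unchanged ty@(ty-wh0 _ tyc _) (ev-wh1 _ (ev-seq d rest)) y lt =
      trans (higherTiers-unchanged ty rest y lt) (higherTiers-unchanged tyc d y lt)

    unmentioned-unchanged : ⇓C μ c μ′ → ∀ y → y ∉ varsC S c → get S μ′ y ≡ get S μ y
    unmentioned-unchanged ev-skip y _ = refl
    unmentioned-unchanged {μ = μ} (ev-asg {x = x} {w = w} _) y y∉ = get-set-≢ S μ x y w (λ y≡x → y∉ (here y≡x))
    unmentioned-unchanged {c = c₁ ⨟ _} (ev-seq d₁ d₂) y y∉ =
      trans (unmentioned-unchanged d₂ y (y∉ ∘ ∈-++⁺ʳ (varsC S c₁))) (unmentioned-unchanged d₁ y (y∉ ∘ ∈-++⁺ˡ))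
    unmentioned-unchanged {c = ifte e _ _} (ev-if1 _ d) y y∉ =
      unmentioned-unchanged d y (y∉ ∘ ∈-++⁺ʳ (varsE S e) ∘ ∈-++⁺ˡ)
    unmentioned-unchanged {c = ifte e c₁ _} (ev-if0 _ d) y y∉ =
      unmentioned-unchanged d y (y∉ ∘ ∈-++⁺ʳ (varsE S e) ∘ ∈-++⁺ʳ (varsC S c₁))
    unmentioned-unchanged (ev-wh0 _) y _ = refl
    unmentioned-unchanged {c = while e _} (ev-wh1 _ (ev-seq d rest)) y y∉ =
      trans (unmentioned-unchanged rest y y∉) (unmentioned-unchanged d y (y∉ ∘ ∈-++⁺ʳ (varsE S e)))

    agree-aboveTier : ⊢C c tc tin tout → tc < s → ⇓C μ c μ′ → ⇓C ν c ν′ → Agree s μ ν → Agree s μ′ ν′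
    agree-aboveTier ty tc<s d d′ a = mkAgree λ y s≤y →
      trans (higherTiers-unchanged ty d y (<-≤-trans tc<s s≤y))
            (trans (agree a y s≤y) (sym (higherTiers-unchanged ty d′ y (<-≤-trans tc<s s≤y))))

    noninterferenceC : ⊢C c tc tin tout → ⇓C μ c μ′ → ⇓C ν c ν′ → Agree s μ ν → Agree s μ′ ν′
    noninterference-while : ⊢E e t tin tout → ⊢C c t t tout′ → s ≤ t →
      (d : ⇓C μ (while e c) μ′) (d′ : ⇓C ν (while e c) ν′) → Agree s μ ν →
      Agree s μ′ ν′ × iterations d ≡ iterations d′
    noninterferenceC (ty-sub ty) d d′ a = noninterferenceC ty d d′ a
    noninterferenceC ty-skip ev-skip ev-skip a = a
    noninterferenceC {μ = μ} {ν = ν} {s = s} (ty-asg {x = x} ty-var tye Γx≤) (ev-asg {w = w} d) (ev-asg {w = w′} d′) a =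
      mkAgree agree′
      where
      agree′ : ∀ y → s ≤ Γ y → get S (set S μ x w) y ≡ get S (set S ν x w′) y
      agree′ y s≤y with y Data.Nat.≟ x
      ... | yes refl = begin
        get S (set S μ x w) x   ≡⟨ get-set-≡ S μ x w ⟩
        just w                  ≡⟨ cong just (noninterferenceE tye d d′ (Agree-anti (≤-trans s≤y Γx≤) a)) ⟩
        just w′                 ≡⟨ get-set-≡ S ν x w′ ⟨
        get S (set S ν x w′) x  ∎
        where open ≡-Reasoning
      ... | no y≢x = trans (get-set-≢ S μ x y w y≢x) (trans (agree a y s≤y) (sym (get-set-≢ S ν x y w′ y≢x)))
    noninterferenceC (ty-seq ty₁ ty₂) (ev-seq d₁ d₂) (ev-seq d₁′ d₂′) a =
      noninterferenceC ty₂ d₂ d₂′ (noninterferenceC ty₁ d₁ d₁′ a)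
    noninterferenceC {tc = tc} {s = s} ty@(ty-if tye ty₁ ty₀) d d′ a with s ≤? tc
    ... | no s≰tc = agree-aboveTier ty (≰⇒> s≰tc) d d′ a
    ... | yes s≤tc with d | d′
    ...   | ev-if1 _ b | ev-if1 _ b′ = noninterferenceC ty₁ b b′ a
    ...   | ev-if0 _ b | ev-if0 _ b′ = noninterferenceC ty₀ b b′ a
    ...   | ev-if1 g _ | ev-if0 g′ _ = ⊥-elim (w1≢w0 (noninterferenceE tye g g′ (Agree-anti s≤tc a)))
    ...   | ev-if0 g _ | ev-if1 g′ _ = ⊥-elim (w1≢w0 (sym (noninterferenceE tye g g′ (Agree-anti s≤tc a))))
    noninterferenceC {tc = tc} {s = s} ty@(ty-wh tye tyc _ _) d d′ a with s ≤? tc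
    ... | no s≰tc  = agree-aboveTier ty (≰⇒> s≰tc) d d′ a
    ... | yes s≤tc = proj₁ (noninterference-while tye tyc s≤tc d d′ a)
    noninterferenceC {tc = tc} {s = s} ty@(ty-wh0 tye tyc _) d d′ a with s ≤? tc
    ... | no s≰tc  = agree-aboveTier ty (≰⇒> s≰tc) d d′ a
    ... | yes s≤tc = proj₁ (noninterference-while tye tyc s≤tc d d′ a)
    noninterference-while tye tyc s≤t (ev-wh0 g) (ev-wh0 g′) a = a , refl
    noninterference-while tye tyc s≤t (ev-wh1 g (ev-seq b rest)) (ev-wh1 g′ (ev-seq b′ rest′)) a =
      let a′ , same = noninterference-while tye tyc s≤t rest rest′ (noninterferenceC tyc b b′ a)
      in a′ , cong suc same
    noninterference-while tye tyc s≤t (ev-wh0 g) (ev-wh1 g′ _) a =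
      ⊥-elim (w1≢w0 (sym (noninterferenceE tye g g′ (Agree-anti s≤t a))))
    noninterference-while tye tyc s≤t (ev-wh1 g _) (ev-wh0 g′) a =
      ⊥-elim (w1≢w0 (noninterferenceE tye g g′ (Agree-anti s≤t a)))

    module Confinement {P : W S → Set} {Q : Var → Set} (cl : NeutralClosed P) where

      -- Such an expression makes no oracle call (those are typed below the
      -- input tier) and all its operators of positive arity are neutral.
      confinedE : ⊢E e r tin tout → tin ≤ r → All Q (varsE S e) → All P (constsE S e) →
                  ⇓E μ e w → Holds r Q P μ → P w
      confinedEs : ⊢Es es ts tin tout → tin ≤ r → AllV (r ≤_) ts → All Q (varsEs S es) →
                   All P (constsEs S es) → ⇓Es μ es ws → Holds r Q P μ → AllV P ws
      confinedE ty-var _ (q ∷ []) _ (ev-var μx) h = holds h _ q ≤-refl μx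
      confinedE (ty-op {o = o} δ tys) tin≤r Qvars Pconsts (ev-op ds) h =
        let Pnullary , Pargs = All.++⁻ (nullaryValue S (ar o) (sem o)) Pconsts
        in op-closed cl δ tin≤r (confinedEs tys tin≤r (argTiers≥ δ) Qvars Pargs ds h) Pnullary
      confinedE (ty-or _ _ r<tin _) tin≤r _ _ _ _ = ⊥-elim (<-irrefl refl (<-≤-trans r<tin tin≤r))
      confinedEs [] _ _ _ _ [] _ = []
      confinedEs {es = e ∷ _} (ty ∷ tys) tin≤r (r≤t ∷ r≤ts) Qvars Pconsts (d ∷ ds) h =
        let Qe , Qes = All.++⁻ (varsE S e) Qvars
            Pe , Pes = All.++⁻ (constsE S e) Pconsts
        in confinedE ty (≤-trans tin≤r r≤t) Qe Pe d (Holds-anti r≤t h) ∷ confinedEs tys tin≤r r≤ts Qes Pes ds h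

      confinedC : ⊢C c tc tin tout → tc ≤ tin → tin ≤ s → All Q (varsC S c) → All P (constsC S c) →
                  ⇓C μ c μ′ → Holds s Q P μ → Holds s Q P μ′
      confinedC (ty-sub ty) tc≤tin tin≤s Qvars Pconsts d h =
        confinedC ty (≤-trans (n≤1+n _) tc≤tin) tin≤s Qvars Pconsts d h
      confinedC ty-skip _ _ _ _ ev-skip h = h
      confinedC {s = s} {μ = μ} (ty-asg {x = x} ty-var tye Γx≤) _ tin≤s (_ ∷ Qe) Pconsts (ev-asg {w = w} d) h =
        mkHolds holds′
        where
        holds′ : ∀ y {w′} → Q y → s ≤ Γ y → get S (set S μ x w) y ≡ just w′ → P w′
        holds′ y q s≤y eq with y Data.Nat.≟ x
        ... | yes refl = subst P (just-injective (trans (sym (get-set-≡ S μ x w)) eq))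
                           (confinedE tye (≤-trans tin≤s (≤-trans s≤y Γx≤)) Qe Pconsts d (Holds-anti (≤-trans s≤y Γx≤) h))
        ... | no y≢x = holds h y q s≤y (trans (sym (get-set-≢ S μ x y w y≢x)) eq)
      confinedC {c = c₁ ⨟ _} (ty-seq ty₁ ty₂) tc≤tin tin≤s Qvars Pconsts (ev-seq d₁ d₂) h =
        let Q₁ , Q₂ = All.++⁻ (varsC S c₁) Qvars
            P₁ , P₂ = All.++⁻ (constsC S c₁) Pconsts
        in confinedC ty₂ tc≤tin tin≤s Q₂ P₂ d₂ (confinedC ty₁ tc≤tin tin≤s Q₁ P₁ d₁ h)
      confinedC {c = ifte e c₁ _} (ty-if _ ty₁ _) tc≤tin tin≤s Qvars Pconsts (ev-if1 _ d) h =
        let Q₁ , _ = All.++⁻ (varsC S c₁) (proj₂ (All.++⁻ (varsE S e) Qvars))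
            P₁ , _ = All.++⁻ (constsC S c₁) (proj₂ (All.++⁻ (constsE S e) Pconsts))
        in confinedC ty₁ tc≤tin tin≤s Q₁ P₁ d h
      confinedC {c = ifte e c₁ _} (ty-if _ _ ty₀) tc≤tin tin≤s Qvars Pconsts (ev-if0 _ d) h =
        let _ , Q₀ = All.++⁻ (varsC S c₁) (proj₂ (All.++⁻ (varsE S e) Qvars))
            _ , P₀ = All.++⁻ (constsC S c₁) (proj₂ (All.++⁻ (constsE S e) Pconsts))
        in confinedC ty₀ tc≤tin tin≤s Q₀ P₀ d h
      confinedC (ty-wh _ _ _ _) _ _ _ _ (ev-wh0 _) h = h
      confinedC {c = while e _} ty@(ty-wh _ tyc _ _) tc≤tin tin≤s Qvars Pconsts (ev-wh1 _ (ev-seq d rest)) h =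
        confinedC ty tc≤tin tin≤s Qvars Pconsts rest
          (confinedC tyc ≤-refl (≤-trans tc≤tin tin≤s)
            (proj₂ (All.++⁻ (varsE S e) Qvars)) (proj₂ (All.++⁻ (constsE S e) Pconsts)) d h)
      confinedC (ty-wh0 _ _ _) _ _ _ _ (ev-wh0 _) h = h
      confinedC {c = while e _} ty@(ty-wh0 _ tyc _) tc≤tin tin≤s Qvars Pconsts (ev-wh1 _ (ev-seq d rest)) h =
        confinedC ty tc≤tin tin≤s Qvars Pconsts rest
          (confinedC tyc ≤-refl (≤-trans tc≤tin tin≤s)
            (proj₂ (All.++⁻ (varsE S e) Qvars)) (proj₂ (All.++⁻ (constsE S e) Pconsts)) d h)

    sizeE≤sizeExpr : (d : ⇓E μ e w) → sizeE S φ d ≤ sizeExpr S e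
    sizeEs≤sizeExprs : (ds : ⇓Es μ es ws) → sizeEs S φ ds ≤ sizeExprs S es
    sizeE≤sizeExpr (ev-var _)    = ≤-refl
    sizeE≤sizeExpr (ev-op ds)    = s≤s (sizeEs≤sizeExprs ds)
    sizeE≤sizeExpr (ev-or d₁ d₂) = s≤s (+-mono-≤ (sizeE≤sizeExpr d₁) (sizeE≤sizeExpr d₂))
    sizeEs≤sizeExprs []          = z≤n
    sizeEs≤sizeExprs (d ∷ ds)    = +-mono-≤ (sizeE≤sizeExpr d) (sizeEs≤sizeExprs ds)

  loopVars : Tier → Expr S → Cmd S → List Var
  loopVars t e c = filter (λ y → t ≤? Γ y) (varsC S (while e c))

  generatorCount : Tier → Expr S → Cmd S → ℕ
  generatorCount t e c = length (loopVars t e c) + (length (constsC S (while e c)) + 2)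

  -- The h loop variables take values among the factors of h + n + 2 words
  -- of length ≤ x (their initial values, the n constants, 0 and 1), or are
  -- undefined: at most (1 + (h + n + 2)(1 + x)²)ʰ configurations.
  iterationBound : Tier → Expr S → Cmd S → Mono
  iterationBound t e c = powM (suc (generatorCount t e c) , 2) (length (loopVars t e c))

  tierBound : ℕ → Mono → Mono → Mono
  tierBound zero    I D = idM
  tierBound (suc n) I D = idM ⊕ (I ⊗ (D ⊙ tierBound n I D))

  loopGrowth : Tier → Mono → Mono → Mono
  loopGrowth t I D = I ⊗ (D ⊙ tierBound t I D)

  loopSize : Tier → Expr S → Mono → Mono → Mono → Mono
  loopSize t e I D F = (constM 1 ⊕ I) ⊗ (constM (2 + sizeExpr S e) ⊕ (F ⊙ tierBound t I D))

  growthBound : ∀ {c tc tin tout} → ⊢C c tc tin tout → Mono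
  growthBound (ty-sub ty)      = growthBound ty
  growthBound ty-skip          = constM 0
  growthBound (ty-asg _ tye _) = constM (growthE tye)
  growthBound (ty-seq ty₁ ty₂) = growthBound ty₁ ⊕ (growthBound ty₂ ⊙ (idM ⊕ growthBound ty₁))
  growthBound (ty-if _ ty₁ ty₀) = growthBound ty₁ ⊕ growthBound ty₀
  growthBound (ty-wh  {e} {c} {t} _ tyc _ _) = loopGrowth t (iterationBound t e c) (growthBound tyc)
  growthBound (ty-wh0 {e} {c} {t} _ tyc _)   = loopGrowth t (iterationBound t e c) (growthBound tyc)

  sizeBound : ∀ {c tc tin tout} → ⊢C c tc tin tout → Mono
  sizeBound (ty-sub ty)              = sizeBound ty
  sizeBound ty-skip                  = constM 1
  sizeBound (ty-asg {e = e} _ _ _)   = constM (suc (sizeExpr S e))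
  sizeBound (ty-seq ty₁ ty₂)         = constM 1 ⊕ (sizeBound ty₁ ⊕ (sizeBound ty₂ ⊙ (idM ⊕ growthBound ty₁)))
  sizeBound (ty-if {e} _ ty₁ ty₀)    = constM (suc (sizeExpr S e)) ⊕ (sizeBound ty₁ ⊕ sizeBound ty₀)
  sizeBound (ty-wh  {e} {c} {t} _ tyc _ _) =
    loopSize t e (iterationBound t e c) (growthBound tyc) (sizeBound tyc)
  sizeBound (ty-wh0 {e} {c} {t} _ tyc _)   =
    loopSize t e (iterationBound t e c) (growthBound tyc) (sizeBound tyc)

  module Bounds (φ : Oracle S) (K : ℕ) (1≤K : 1 ≤ K) where
    open Run φ

    private variable
      e : Expr S
      c : Cmd S
      n : ℕ
      es : Vec (Expr S) n
      ts : Vec Tier n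
      w : W S
      ws : Vec (W S) n
      μ μ′ μ″ : Store S
      r s t tc tin tout tout′ : Tier
      X : ℕ

    ConstsBelowK : List (W S) → Set
    ConstsBelowK = All (λ w → length w ≤ K)

    consts-if : ∀ e c₁ c₀ → ConstsBelowK (constsC S (ifte e c₁ c₀)) →
                ConstsBelowK (constsC S c₁) × ConstsBelowK (constsC S c₀)
    consts-if e c₁ c₀ consts≤K = All.++⁻ (constsC S c₁) (proj₂ (All.++⁻ (constsE S e) consts≤K))

    consts-body : ∀ e c → ConstsBelowK (constsC S (while e c)) → ConstsBelowK (constsC S c)
    consts-body e c consts≤K = proj₂ (All.++⁻ (constsE S e) consts≤K)

    lengthE≤ : (ty : ⊢E e r tin tout) (d : ⇓E μ e w) → Bounded r X μ → K ≤ X →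
               oracleMaxE S φ d ≤ X → ConstsBelowK (constsE S e) → length w ≤ X + growthE ty
    lengthEs≤ : (tys : ⊢Es es ts tin tout) (ds : ⇓Es μ es ws) → AllV (r ≤_) ts → Bounded r X μ → K ≤ X →
                oracleMaxEs S φ ds ≤ X → ConstsBelowK (constsEs S es) → AllV (λ w → length w ≤ X + growthEs tys) ws
    lengthE≤ {X = X} ty-var (ev-var μx) h _ _ _ = ≤-trans (holds h _ tt ≤-refl μx) (m≤m+n X 0)
    lengthE≤ {e = op o _} {X = X} (ty-op δ tys) (ev-op {ws = ws} ds) h K≤X oracle≤ consts≤ =
      let nullary≤ , args≤ = All.++⁻ (nullaryValue S (ar o) (sem o)) consts≤
          K≤X+g = ≤-trans K≤X (m≤m+n X _)
      in ≤-trans (proj₂ (op-affine δ) ws (≤-trans 1≤K K≤X+g)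
                   (lengthEs≤ tys ds (argTiers≥ δ) h K≤X oracle≤ args≤)
                   (All.map (λ ≤K → ≤-trans ≤K K≤X+g) nullary≤))
                 (≤-reflexive (+-assoc X (growthEs tys) _))
    lengthE≤ {X = X} (ty-or _ _ _ _) (ev-or _ _) _ _ oracle≤ _ = ≤-trans (m⊔n≤o⇒m≤o _ _ oracle≤) (m≤m+n X 0)
    lengthEs≤ [] [] _ _ _ _ _ = []
    lengthEs≤ {es = e ∷ _} {X = X} (ty ∷ tys) (d ∷ ds) (r≤t ∷ r≤ts) h K≤X oracle≤ consts≤ =
      let consts≤e , consts≤es = All.++⁻ (constsE S e) consts≤
      in ≤-trans (lengthE≤ ty d (Holds-anti r≤t h) K≤X (m⊔n≤o⇒m≤o _ _ oracle≤) consts≤e)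
                 (+-monoʳ-≤ X (m≤m+n _ _)) ∷
         AllV.map (λ |w|≤ → ≤-trans |w|≤ (+-monoʳ-≤ X (m≤n+m _ (growthE ty))))
           (lengthEs≤ tys ds r≤ts h K≤X (m⊔n≤o⇒n≤o _ _ oracle≤) consts≤es)

    states : ⇓C μ (while e c) μ′ → List (Store S)
    states {μ = μ} (ev-wh0 _)                 = μ ∷ []
    states {μ = μ} (ev-wh1 _ (ev-seq _ rest)) = μ ∷ states rest

    length-states : (d : ⇓C μ (while e c) μ′) → length (states d) ≡ suc (iterations d)
    length-states (ev-wh0 _)                 = refl
    length-states (ev-wh1 _ (ev-seq _ rest)) = cong suc (length-states rest)

    -- A loop of tier t never revisits a configuration of its tier-≥t
    -- variables: by noninterference the number of remaining iterations is
    -- a function of that configuration, and it decreases strictly.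
    module IterationCount (tye : ⊢E e t tin tout) (tyc : ⊢C c t t tout′) (μ₀ : Store S) where
      V : List Var
      V = varsC S (while e c)

      configuration : Store S → List (Maybe (W S))
      configuration ν = map (get S ν) (loopVars t e c)

      generators : List (W S)
      generators = catMaybes (configuration μ₀) ++ (constsC S (while e c) ++ w0 ∷ w1 ∷ [])

      reachable : List (W S)
      reachable = concatMap factors generators

      Reachable : W S → Set
      Reachable w = w ∈ reachable

      generator-reachable : ∀ {w} → w ∈ generators → Reachable w
      generator-reachable = ∈-concatMap⁺′ factors (∈-factors⁺ (⊴-refl _))

      reachable-closed : NeutralClosed Reachable
      reachable-closed = record
        { ⊴-closed = λ v⊴u u∈ → let g , g∈ , u∈fg = ∈-concatMap⁻′ factors {generators} u∈
                                in ∈-concatMap⁺′ factors (∈-factors⁺ (⊴-trans v⊴u (∈-factors⁻ g u∈fg))) g∈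
        ; ∋w0 = generator-reachable (∈-++⁺ʳ (catMaybes (configuration μ₀)) (∈-++⁺ʳ (constsC S (while e c)) (here refl)))
        ; ∋w1 = generator-reachable (∈-++⁺ʳ (catMaybes (configuration μ₀)) (∈-++⁺ʳ (constsC S (while e c)) (there (here refl))))
        ; decide = λ w → w ∈? reachable
        }
        where open import Data.List.Membership.DecPropositional (≡-dec Fin._≟_) using (_∈?_)

      open Confinement {Q = _∈ V} reachable-closed

      Invariant : Store S → Set
      Invariant = Holds t (_∈ V) Reachable

      invariant₀ : Invariant μ₀
      invariant₀ = mkHolds λ y y∈V t≤y μ₀y → generator-reachable (∈-++⁺ˡ (∈-catMaybes⁺ (configuration μ₀)
        (subst (_∈ configuration μ₀) μ₀y (∈-map⁺ (get S μ₀) (∈-filter⁺ (λ y → t ≤? Γ y) y∈V t≤y)))))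

      body-invariant : ⇓C μ c μ′ → Invariant μ → Invariant μ′
      body-invariant = confinedC tyc ≤-refl ≤-refl
        (All.tabulate (∈-++⁺ʳ (varsE S e)))
        (All.tabulate λ w∈ → generator-reachable
          (∈-++⁺ʳ (catMaybes (configuration μ₀)) (∈-++⁺ˡ (∈-++⁺ʳ (constsE S e) w∈))))

      record LaterState (μ : Store S) (n : ℕ) (ν : Store S) : Set where
        constructor laterState
        field
          {ν′}        : Store S
          run         : ⇓C ν (while e c) ν′
          iterations≤ : iterations run ≤ n
          unmentioned : ∀ y → y ∉ V → get S ν y ≡ get S μ y
          invariant   : Invariant ν

      laterStates : (d : ⇓C μ (while e c) μ′) → Invariant μ → All (LaterState μ (iterations d)) (states d)
      laterStates d@(ev-wh0 _) inv = laterState d ≤-refl (λ _ _ → refl) inv ∷ []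
      laterStates d@(ev-wh1 _ (ev-seq b rest)) inv =
        laterState d ≤-refl (λ _ _ → refl) inv ∷
        All.map (λ (laterState run n≤ unmentioned inv′) → laterState run (m≤n⇒m≤1+n n≤)
                  (λ y y∉ → trans (unmentioned y y∉) (unmentioned-unchanged b y (y∉ ∘ ∈-++⁺ʳ (varsE S e))))
                  inv′)
          (laterStates rest (body-invariant b inv))

      distinct-configurations : (d : ⇓C μ (while e c) μ′) → Invariant μ →
                                AllPairs _≢_ (map configuration (states d))
      distinct-configurations (ev-wh0 _) _ = [] ∷ []
      distinct-configurations {μ = μ} d@(ev-wh1 _ (ev-seq b rest)) inv =
        All.map⁺ (All.map differs (laterStates rest (body-invariant b inv))) ∷
        distinct-configurations rest (body-invariant b inv)
        where
        differs : ∀ {ν} → LaterState _ (iterations rest) ν → configuration μ ≢ configuration ν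
        differs {ν} later same = <-irrefl refl (≤-trans (≤-reflexive same-iterations) (LaterState.iterations≤ later))
          where
          agree-t : Agree t μ ν
          agree-t = mkAgree λ y t≤y → case y ∈ℕ? V of λ where
            (yes y∈V) → map≡⇒pointwise (loopVars t e c) same (∈-filter⁺ (λ y → t ≤? Γ y) y∈V t≤y)
            (no y∉V)  → trans (sym (unmentioned-unchanged b y (y∉V ∘ ∈-++⁺ʳ (varsE S e))))
                              (sym (LaterState.unmentioned later y y∉V))
          same-iterations : suc (iterations rest) ≡ iterations (LaterState.run later)
          same-iterations = proj₂ (noninterference-while tye tyc ≤-refl d (LaterState.run later) agree-t)

      configurations : List (List (Maybe (W S)))
      configurations = listsOver (length (loopVars t e c)) (nothing ∷ map just reachable)

      configuration∈ : ∀ {ν} → Invariant ν → configuration ν ∈ configurations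
      configuration∈ {ν} inv = subst (λ n → configuration ν ∈ listsOver n _) (length-map (get S ν) (loopVars t e c))
        (∈-listsOver (configuration ν) (All.map⁺ (All.tabulate λ {y} y∈ →
          let y∈V , t≤y = ∈-filter⁻ (λ y → t ≤? Γ y) y∈ in entry∈ (get S ν y) (holds inv y y∈V t≤y))))
        where
        entry∈ : ∀ m → (∀ {w} → m ≡ just w → Reachable w) → m ∈ nothing ∷ map just reachable
        entry∈ nothing  _         = here refl
        entry∈ (just w) reachable = there (∈-map⁺ just (reachable refl))

      suc-iterations≤ : (d : ⇓C μ₀ (while e c) μ′) →
                        suc (iterations d) ≤ suc (length reachable) ^ length (loopVars t e c)
      suc-iterations≤ d = begin
        suc (iterations d)                     ≡⟨ length-states d ⟨
        length (states d)                      ≡⟨ length-map configuration (states d) ⟨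
        length (map configuration (states d))  ≤⟨ distinct⊆⇒length≤ _ configurations (distinct-configurations d invariant₀)
                                                    (All.map⁺ (All.map (configuration∈ ∘ LaterState.invariant) (laterStates d invariant₀))) ⟩
        length configurations                  ≤⟨ length-listsOver (length (loopVars t e c)) (nothing ∷ map just reachable) ⟩
        length (nothing ∷ map just reachable) ^ length (loopVars t e c)  ≡⟨ cong (λ n → suc n ^ length (loopVars t e c)) (length-map just reachable) ⟩
        suc (length reachable) ^ length (loopVars t e c) ∎
        where open ≤-Reasoning

      module _ {x : ℕ} (bounded₀ : Bounded t x μ₀) (K≤x : K ≤ x)
               (consts≤K : ConstsBelowK (constsC S (while e c))) where
        generator≤ : ∀ {w} → w ∈ generators → length w ≤ x
        generator≤ w∈ with ∈-++⁻ (catMaybes (configuration μ₀)) w∈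
        ... | inj₁ p with ∈-map⁻ (get S μ₀) {xs = loopVars t e c} (∈-catMaybes⁻ (configuration μ₀) p)
        ...   | y , y∈ , just≡ = holds bounded₀ y tt (proj₂ (∈-filter⁻ (λ y → t ≤? Γ y) {xs = V} y∈)) (sym just≡)
        generator≤ w∈ | inj₂ p with ∈-++⁻ (constsC S (while e c)) p
        ... | inj₁ q                 = ≤-trans (All.lookup consts≤K q) K≤x
        ... | inj₂ (here refl)       = ≤-trans 1≤K K≤x
        ... | inj₂ (there (here refl)) = ≤-trans 1≤K K≤x

        length-generators : length generators ≤ generatorCount t e c
        length-generators = begin
          length generators
            ≡⟨ length-++ (catMaybes (configuration μ₀)) ⟩
          length (catMaybes (configuration μ₀)) + length (constsC S (while e c) ++ w0 ∷ w1 ∷ [])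
            ≤⟨ +-mono-≤ (≤-trans (length-catMaybes (configuration μ₀)) (≤-reflexive (length-map (get S μ₀) (loopVars t e c))))
                        (≤-reflexive (length-++ (constsC S (while e c)))) ⟩
          length (loopVars t e c) + (length (constsC S (while e c)) + 2) ∎
          where open ≤-Reasoning

        length-configurationEntries : suc (length reachable) ≤ ⟦ suc (generatorCount t e c) , 2 ⟧ x
        length-configurationEntries = begin
          suc (length reachable)
            ≤⟨ s≤s (length-concatMap≤ factors (suc x * suc x) generators (All.tabulate λ {g} g∈ →
                 ≤-trans (length-factors g) (*-mono-≤ (s≤s (generator≤ g∈)) (s≤s (generator≤ g∈))))) ⟩
          suc (length generators * (suc x * suc x))
            ≤⟨ +-mono-≤ (m^n>0 (suc x) 2) (*-monoˡ-≤ (suc x * suc x) length-generators) ⟩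
          suc x ^ 2 + generatorCount t e c * (suc x * suc x)
            ≡⟨ cong (λ z → suc x ^ 2 + generatorCount t e c * (suc x * z)) (*-identityʳ (suc x)) ⟨
          suc (generatorCount t e c) * suc x ^ 2 ∎
          where open ≤-Reasoning

        iterations≤ : (d : ⇓C μ₀ (while e c) μ′) → iterations d ≤ ⟦ iterationBound t e c ⟧ x
        iterations≤ d = begin
          iterations d                                ≤⟨ n≤1+n _ ⟩
          suc (iterations d)                          ≤⟨ suc-iterations≤ d ⟩
          suc (length reachable) ^ length (loopVars t e c) ≤⟨ ^-monoˡ-≤ (length (loopVars t e c)) length-configurationEntries ⟩
          ⟦ suc (generatorCount t e c) , 2 ⟧ x ^ length (loopVars t e c) ≤⟨ ⟦powM⟧ _ (length (loopVars t e c)) x ⟩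
          ⟦ iterationBound t e c ⟧ x                  ∎
          where open ≤-Reasoning

    GrowsBy : Mono → Cmd S → Set
    GrowsBy D c = ∀ {μ μ′} (π : ⇓C μ c μ′) {s X Y Z} → K ≤ Z → oracleMaxC S φ π ≤ Z → Z ≤ X → Z ≤ Y →
                  Bounded s X μ → Bounded (suc s) Y μ → Bounded s (X + ⟦ D ⟧ Y) μ′

    SizeWithin : Mono → Cmd S → Set
    SizeWithin F c = ∀ {μ μ′} (π : ⇓C μ c μ′) {X Z} → K ≤ Z → oracleMaxC S φ π ≤ Z → Z ≤ X →
                     Bounded 1 X μ → sizeC S φ π ≤ ⟦ F ⟧ X

    module _ (g : ⇓E μ e w1) (b : ⇓C μ c μ′) (rest : ⇓C μ′ (while e c) μ″) {Z : ℕ}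
             (oracle≤ : oracleMaxC S φ (ev-wh1 g (ev-seq b rest)) ≤ Z) where
      oracle≤-body : oracleMaxC S φ b ≤ Z
      oracle≤-body = m⊔n≤o⇒m≤o _ _ (m⊔n≤o⇒n≤o (oracleMaxE S φ g) _ oracle≤)

      oracle≤-rest : oracleMaxC S φ rest ≤ Z
      oracle≤-rest = m⊔n≤o⇒n≤o _ _ (m⊔n≤o⇒n≤o (oracleMaxE S φ g) _ oracle≤)

    module Loop (tye : ⊢E e t tin tout) (tyc : ⊢C c t t tout′)
                (consts≤K : ConstsBelowK (constsC S (while e c))) (1≤t : 1 ≤ t)
                (D : Mono) (body-grows : GrowsBy D c) where
      I : Mono
      I = iterationBound t e c

      iterations≤ : ∀ {μ μ′ x} (d : ⇓C μ (while e c) μ′) → Bounded t x μ → K ≤ x → iterations d ≤ ⟦ I ⟧ x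
      iterations≤ {μ} d bounded K≤x = IterationCount.iterations≤ tye tyc μ bounded K≤x consts≤K d

      bounded-stable : ∀ {μ μ′ s x} (d : ⇓C μ (while e c) μ′) → t ≤ s → K ≤ x → Bounded s x μ →
                       All (Bounded s x) (states d) × Bounded s x μ′
      bounded-stable {s = s} {x} d t≤s K≤x = go d
        where
        open Confinement {Q = λ _ → ⊤} (length≤-closed (≤-trans 1≤K K≤x))
        body-stable : ∀ {μ μ′} → ⇓C μ c μ′ → Bounded s x μ → Bounded s x μ′
        body-stable = confinedC tyc ≤-refl t≤s (All.universal (λ _ → tt) _)
                        (All.map (λ ≤K → ≤-trans ≤K K≤x) (consts-body e c consts≤K))
        go : ∀ {μ μ′} (d : ⇓C μ (while e c) μ′) → Bounded s x μ → All (Bounded s x) (states d) × Bounded s x μ′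
        go (ev-wh0 _) h = h ∷ [] , h
        go (ev-wh1 _ (ev-seq b rest)) h = let hs , h′ = go rest (body-stable b h) in h ∷ hs , h′

      bounded-accumulate : ∀ {μ μ′ s X Y Z} (d : ⇓C μ (while e c) μ′) →
        K ≤ Z → oracleMaxC S φ d ≤ Z → Z ≤ X → Z ≤ Y → Bounded s X μ → All (Bounded (suc s) Y) (states d) →
        All (Bounded s (X + iterations d * ⟦ D ⟧ Y)) (states d) × Bounded s (X + iterations d * ⟦ D ⟧ Y) μ′
      bounded-accumulate {X = X} (ev-wh0 _) _ _ _ _ h _ =
        Bounded-mono (m≤m+n X 0) h ∷ [] , Bounded-mono (m≤m+n X 0) h
      bounded-accumulate {X = X} {Y} d@(ev-wh1 g (ev-seq b rest)) K≤Z oracle≤ Z≤X Z≤Y h (hY ∷ hYs) =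
        let hs , h′ = bounded-accumulate rest K≤Z (oracle≤-rest g b rest oracle≤) (≤-trans Z≤X (m≤m+n X _)) Z≤Y
                        (body-grows b K≤Z (oracle≤-body g b rest oracle≤) Z≤X Z≤Y h hY) hYs
        in Bounded-mono (m≤m+n X _) h ∷ All.map (Bounded-mono (≤-reflexive assoc)) hs , Bounded-mono (≤-reflexive assoc) h′
        where
        assoc : X + ⟦ D ⟧ Y + iterations rest * ⟦ D ⟧ Y ≡ X + iterations d * ⟦ D ⟧ Y
        assoc = +-assoc X (⟦ D ⟧ Y) (iterations rest * ⟦ D ⟧ Y)

      ⟦tierBound⟧≥ : ∀ n x → x ≤ ⟦ tierBound n I D ⟧ x
      ⟦tierBound⟧≥ zero    x = ⟦idM⟧ x
      ⟦tierBound⟧≥ (suc n) x = ≤-trans (⟦idM⟧ x) (⟦⊕⟧ˡ idM (I ⊗ (D ⊙ tierBound n I D)) x)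

      ⟦tierBound⟧-suc : ∀ n x k → k ≤ ⟦ I ⟧ x → x + k * ⟦ D ⟧ (⟦ tierBound n I D ⟧ x) ≤ ⟦ tierBound (suc n) I D ⟧ x
      ⟦tierBound⟧-suc n x k k≤ = begin
        x + k * ⟦ D ⟧ (⟦ tierBound n I D ⟧ x)      ≤⟨ +-mono-≤ (⟦idM⟧ x) (*-mono-≤ k≤ (⟦⊙⟧ D (tierBound n I D) x)) ⟩
        ⟦ idM ⟧ x + ⟦ I ⟧ x * ⟦ D ⊙ tierBound n I D ⟧ x ≤⟨ +-monoʳ-≤ (⟦ idM ⟧ x) (⟦⊗⟧ I (D ⊙ tierBound n I D) x) ⟩
        ⟦ idM ⟧ x + ⟦ I ⊗ (D ⊙ tierBound n I D) ⟧ x  ≤⟨ ⟦⊕⟧ idM (I ⊗ (D ⊙ tierBound n I D)) x ⟩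
        ⟦ tierBound (suc n) I D ⟧ x                  ∎
        where open ≤-Reasoning

      -- Induction on the number n of tiers between s and t: tier s grows by
      -- at most I(x) increments, each bounded by D of the bound on tier s + 1.
      tier-bounded : ∀ n {μ μ′ s x Z} (d : ⇓C μ (while e c) μ′) → K ≤ Z → oracleMaxC S φ d ≤ Z → Z ≤ x →
                     t ≤ s + n → Bounded s x μ → All (Bounded s (⟦ tierBound n I D ⟧ x)) (states d)
      tier-bounded zero {s = s} {x} d K≤Z _ Z≤x t≤s+0 h =
        All.map (Bounded-mono (⟦tierBound⟧≥ 0 x))
          (proj₁ (bounded-stable d (≤-trans t≤s+0 (≤-reflexive (+-identityʳ s))) (≤-trans K≤Z Z≤x) h))
      tier-bounded (suc n) {s = s} {x} d K≤Z oracle≤ Z≤x t≤s+1+n h with t ≤? s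
      ... | yes t≤s = All.map (Bounded-mono (⟦tierBound⟧≥ (suc n) x)) (proj₁ (bounded-stable d t≤s (≤-trans K≤Z Z≤x) h))
      ... | no t≰s =
        All.map (Bounded-mono (⟦tierBound⟧-suc n x (iterations d)
                   (iterations≤ d (Holds-anti (<⇒≤ (≰⇒> t≰s)) h) (≤-trans K≤Z Z≤x))))
          (proj₁ (bounded-accumulate d K≤Z oracle≤ Z≤x (≤-trans Z≤x (⟦tierBound⟧≥ n x)) h
            (tier-bounded n d K≤Z oracle≤ Z≤x (≤-trans t≤s+1+n (≤-reflexive (+-suc s n))) (Holds-anti (n≤1+n s) h))))

      grows : GrowsBy (loopGrowth t I D) (while e c)
      grows {μ} π {s} {X} {Y} K≤Z oracle≤ Z≤X Z≤Y hX hY with t ≤? s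
      ... | yes t≤s = Bounded-mono (m≤m+n X _) (proj₂ (bounded-stable π t≤s (≤-trans K≤Z Z≤X) hX))
      ... | no t≰s = Bounded-mono (+-monoʳ-≤ X increment≤)
        (proj₂ (bounded-accumulate π K≤Z oracle≤ Z≤X (≤-trans Z≤Y (⟦tierBound⟧≥ t Y)) hX
                  (tier-bounded t π K≤Z oracle≤ Z≤Y (m≤n+m t (suc s)) hY)))
        where
        increment≤ : iterations π * ⟦ D ⟧ (⟦ tierBound t I D ⟧ Y) ≤ ⟦ loopGrowth t I D ⟧ Y
        increment≤ = ≤-trans (*-mono-≤ (iterations≤ π (Holds-anti (≰⇒> t≰s) hY) (≤-trans K≤Z Z≤Y))
                                        (⟦⊙⟧ D (tierBound t I D) Y))
                             (⟦⊗⟧ I (D ⊙ tierBound t I D) Y)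

      module _ (F : Mono) (body-size : SizeWithin F c) where
        size-while≤ : ∀ {μ μ′ Y Z} (d : ⇓C μ (while e c) μ′) → K ≤ Z → oracleMaxC S φ d ≤ Z → Z ≤ Y →
                      All (Bounded 1 Y) (states d) → sizeC S φ d ≤ suc (iterations d) * (2 + sizeExpr S e + ⟦ F ⟧ Y)
        size-while≤ {Y = Y} (ev-wh0 g) _ _ _ _ = begin
          suc (sizeE S φ g)                   ≤⟨ s≤s (sizeE≤sizeExpr g) ⟩
          suc (sizeExpr S e)                  ≤⟨ m≤m+n _ (⟦ F ⟧ Y) ⟩
          suc (sizeExpr S e) + ⟦ F ⟧ Y        ≤⟨ n≤1+n _ ⟩
          2 + sizeExpr S e + ⟦ F ⟧ Y          ≡⟨ +-identityʳ _ ⟨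
          1 * (2 + sizeExpr S e + ⟦ F ⟧ Y)    ∎
          where open ≤-Reasoning
        size-while≤ {Y = Y} (ev-wh1 g (ev-seq b rest)) K≤Z oracle≤ Z≤Y (hY ∷ hYs) = begin
          suc (sizeE S φ g + suc (sizeC S φ b + sizeC S φ rest))
            ≤⟨ s≤s (+-mono-≤ (sizeE≤sizeExpr g) (s≤s (+-mono-≤ (body-size b K≤Z (oracle≤-body g b rest oracle≤) Z≤Y hY)
                                                                 (size-while≤ rest K≤Z (oracle≤-rest g b rest oracle≤) Z≤Y hYs)))) ⟩
          suc (sizeExpr S e + suc (⟦ F ⟧ Y + R))
            ≡⟨ cong suc (trans (+-suc (sizeExpr S e) _) (cong suc (sym (+-assoc (sizeExpr S e) (⟦ F ⟧ Y) R)))) ⟩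
          2 + sizeExpr S e + ⟦ F ⟧ Y + R ∎
          where
          open ≤-Reasoning
          R : ℕ
          R = suc (iterations rest) * (2 + sizeExpr S e + ⟦ F ⟧ Y)

        sizeWithin : SizeWithin (loopSize t e I D F) (while e c)
        sizeWithin {μ} π {X} K≤Z oracle≤ Z≤X h = begin
          sizeC S φ π
            ≤⟨ size-while≤ π K≤Z oracle≤ (≤-trans Z≤X (⟦tierBound⟧≥ t X)) (tier-bounded t π K≤Z oracle≤ Z≤X (m≤n+m t 1) h) ⟩
          suc (iterations π) * (2 + sizeExpr S e + ⟦ F ⟧ (⟦ tierBound t I D ⟧ X))
            ≤⟨ *-mono-≤ (≤-trans (+-mono-≤ (⟦constM⟧ 1 X) (iterations≤ π (Holds-anti 1≤t h) (≤-trans K≤Z Z≤X)))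
                                  (⟦⊕⟧ (constM 1) I X))
                         (≤-trans (+-mono-≤ (⟦constM⟧ (2 + sizeExpr S e) X) (⟦⊙⟧ F (tierBound t I D) X))
                                  (⟦⊕⟧ (constM (2 + sizeExpr S e)) (F ⊙ tierBound t I D) X)) ⟩
          ⟦ constM 1 ⊕ I ⟧ X * ⟦ constM (2 + sizeExpr S e) ⊕ (F ⊙ tierBound t I D) ⟧ X
            ≤⟨ ⟦⊗⟧ (constM 1 ⊕ I) (constM (2 + sizeExpr S e) ⊕ (F ⊙ tierBound t I D)) X ⟩
          ⟦ loopSize t e I D F ⟧ X ∎
          where open ≤-Reasoning

    growthBound-grows : (ty : ⊢C c tc tin tout) → ConstsBelowK (constsC S c) → GrowsBy (growthBound ty) c
    growthBound-grows (ty-sub ty) consts≤K π = growthBound-grows ty consts≤K π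
    growthBound-grows ty-skip _ ev-skip {X = X} _ _ _ _ hX _ = Bounded-mono (m≤m+n X _) hX
    growthBound-grows (ty-asg {x = x} ty-var tye Γx≤) consts≤K (ev-asg {μ = μ} {w = w} d) {s} {X} {Y}
                      K≤Z oracle≤ Z≤X _ hX _ = mkHolds holds′
      where
      holds′ : ∀ y {w′} → ⊤ → s ≤ Γ y → get S (set S μ x w) y ≡ just w′ → length w′ ≤ X + ⟦ constM (growthE tye) ⟧ Y
      holds′ y _ s≤y eq with y ≟ x
      ... | yes refl rewrite just-injective (trans (sym eq) (get-set-≡ S μ x w)) =
        ≤-trans (lengthE≤ tye d (Holds-anti (≤-trans s≤y Γx≤) hX) (≤-trans K≤Z Z≤X) (≤-trans oracle≤ Z≤X) consts≤K)
                (+-monoʳ-≤ X (⟦constM⟧ (growthE tye) Y))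
      ... | no y≢x = ≤-trans (holds hX y tt s≤y (trans (sym (get-set-≢ S μ x y w y≢x)) eq)) (m≤m+n X _)
    growthBound-grows {c = c₁ ⨟ c₂} (ty-seq ty₁ ty₂) consts≤K (ev-seq {μ₁ = μ₁} d₁ d₂) {s} {X} {Y}
                      K≤Z oracle≤ Z≤X Z≤Y hX hY =
      Bounded-mono bound (growthBound-grows ty₂ consts₂ d₂ K≤Z (m⊔n≤o⇒n≤o _ _ oracle≤)
                           (≤-trans Z≤X (m≤m+n X _)) (≤-trans Z≤Y (m≤m+n Y _)) hX₁ hY₁)
      where
      consts₁ : ConstsBelowK (constsC S c₁)
      consts₁ = proj₁ (All.++⁻ (constsC S c₁) consts≤K)
      consts₂ : ConstsBelowK (constsC S c₂)
      consts₂ = proj₂ (All.++⁻ (constsC S c₁) consts≤K)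
      D₁ D₂ : Mono
      D₁ = growthBound ty₁
      D₂ = growthBound ty₂
      hX₁ : Bounded s (X + ⟦ D₁ ⟧ Y) μ₁
      hX₁ = growthBound-grows ty₁ consts₁ d₁ K≤Z (m⊔n≤o⇒m≤o _ _ oracle≤) Z≤X Z≤Y hX hY
      hY₁ : Bounded (suc s) (Y + ⟦ D₁ ⟧ Y) μ₁
      hY₁ = growthBound-grows ty₁ consts₁ d₁ K≤Z (m⊔n≤o⇒m≤o _ _ oracle≤) Z≤Y Z≤Y hY (Holds-anti (n≤1+n _) hY)
      bound : X + ⟦ D₁ ⟧ Y + ⟦ D₂ ⟧ (Y + ⟦ D₁ ⟧ Y) ≤ X + ⟦ D₁ ⊕ (D₂ ⊙ (idM ⊕ D₁)) ⟧ Y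
      bound = begin
        X + ⟦ D₁ ⟧ Y + ⟦ D₂ ⟧ (Y + ⟦ D₁ ⟧ Y)       ≡⟨ +-assoc X _ _ ⟩
        X + (⟦ D₁ ⟧ Y + ⟦ D₂ ⟧ (Y + ⟦ D₁ ⟧ Y))     ≤⟨ +-monoʳ-≤ X (+-monoʳ-≤ (⟦ D₁ ⟧ Y) (⟦⊙⟧-shift D₂ D₁ Y)) ⟩
        X + (⟦ D₁ ⟧ Y + ⟦ D₂ ⊙ (idM ⊕ D₁) ⟧ Y)     ≤⟨ +-monoʳ-≤ X (⟦⊕⟧ D₁ (D₂ ⊙ (idM ⊕ D₁)) Y) ⟩
        X + ⟦ D₁ ⊕ (D₂ ⊙ (idM ⊕ D₁)) ⟧ Y           ∎
        where open ≤-Reasoning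
    growthBound-grows {c = ifte e c₁ c₀} (ty-if _ ty₁ ty₀) consts≤K (ev-if1 g d) {X = X} {Y} K≤Z oracle≤ Z≤X Z≤Y hX hY =
      Bounded-mono (+-monoʳ-≤ X (⟦⊕⟧ˡ (growthBound ty₁) (growthBound ty₀) Y))
        (growthBound-grows ty₁ (proj₁ (consts-if e c₁ c₀ consts≤K)) d K≤Z (m⊔n≤o⇒n≤o (oracleMaxE S φ g) _ oracle≤) Z≤X Z≤Y hX hY)
    growthBound-grows {c = ifte e c₁ c₀} (ty-if _ ty₁ ty₀) consts≤K (ev-if0 g d) {X = X} {Y} K≤Z oracle≤ Z≤X Z≤Y hX hY =
      Bounded-mono (+-monoʳ-≤ X (⟦⊕⟧ʳ (growthBound ty₁) (growthBound ty₀) Y))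
        (growthBound-grows ty₀ (proj₂ (consts-if e c₁ c₀ consts≤K)) d K≤Z (m⊔n≤o⇒n≤o (oracleMaxE S φ g) _ oracle≤) Z≤X Z≤Y hX hY)
    growthBound-grows {c = while e c} (ty-wh tye tyc 1≤t _) consts≤K =
      Loop.grows tye tyc consts≤K 1≤t _ (growthBound-grows tyc (consts-body e c consts≤K))
    growthBound-grows {c = while e c} (ty-wh0 tye tyc 1≤t) consts≤K =
      Loop.grows tye tyc consts≤K 1≤t _ (growthBound-grows tyc (consts-body e c consts≤K))

    guarded-size≤ : (g : ⇓E μ e w) (F₁ F₀ : Mono) {n X : ℕ} → n ≤ ⟦ F₁ ⊕ F₀ ⟧ X →
                    suc (sizeE S φ g + n) ≤ ⟦ constM (suc (sizeExpr S e)) ⊕ (F₁ ⊕ F₀) ⟧ X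
    guarded-size≤ {e = e} g F₁ F₀ {n} {X} n≤ = begin
      suc (sizeE S φ g + n)                              ≤⟨ s≤s (+-mono-≤ (sizeE≤sizeExpr g) n≤) ⟩
      suc (sizeExpr S e) + ⟦ F₁ ⊕ F₀ ⟧ X                 ≤⟨ +-monoˡ-≤ _ (⟦constM⟧ (suc (sizeExpr S e)) X) ⟩
      ⟦ constM (suc (sizeExpr S e)) ⟧ X + ⟦ F₁ ⊕ F₀ ⟧ X  ≤⟨ ⟦⊕⟧ (constM (suc (sizeExpr S e))) (F₁ ⊕ F₀) X ⟩
      ⟦ constM (suc (sizeExpr S e)) ⊕ (F₁ ⊕ F₀) ⟧ X      ∎
      where open ≤-Reasoning

    sizeBound-bounds : (ty : ⊢C c tc tin tout) → ConstsBelowK (constsC S c) → SizeWithin (sizeBound ty) c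
    sizeBound-bounds (ty-sub ty) consts≤K π = sizeBound-bounds ty consts≤K π
    sizeBound-bounds ty-skip _ ev-skip {X} _ _ _ _ = ⟦constM⟧ 1 X
    sizeBound-bounds (ty-asg {e = e} ty-var _ _) _ (ev-asg d) {X} _ _ _ _ =
      ≤-trans (s≤s (sizeE≤sizeExpr d)) (⟦constM⟧ (suc (sizeExpr S e)) X)
    sizeBound-bounds {c = c₁ ⨟ c₂} (ty-seq ty₁ ty₂) consts≤K (ev-seq {μ₁ = μ₁} d₁ d₂) {X} {Z} K≤Z oracle≤ Z≤X h = begin
      suc (sizeC S φ d₁ + sizeC S φ d₂)
        ≤⟨ s≤s (+-mono-≤ (sizeBound-bounds ty₁ consts₁ d₁ K≤Z oracle≤₁ Z≤X h)
                         (≤-trans (sizeBound-bounds ty₂ consts₂ d₂ K≤Z (m⊔n≤o⇒n≤o _ _ oracle≤) (≤-trans Z≤X (m≤m+n X _)) h₁)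
                                  (⟦⊙⟧-shift F₂ D₁ X))) ⟩
      suc (⟦ F₁ ⟧ X + ⟦ F₂ ⊙ (idM ⊕ D₁) ⟧ X)
        ≤⟨ +-mono-≤ (⟦constM⟧ 1 X) (⟦⊕⟧ F₁ (F₂ ⊙ (idM ⊕ D₁)) X) ⟩
      ⟦ constM 1 ⟧ X + ⟦ F₁ ⊕ (F₂ ⊙ (idM ⊕ D₁)) ⟧ X
        ≤⟨ ⟦⊕⟧ (constM 1) (F₁ ⊕ (F₂ ⊙ (idM ⊕ D₁))) X ⟩
      ⟦ constM 1 ⊕ (F₁ ⊕ (F₂ ⊙ (idM ⊕ D₁))) ⟧ X ∎
      where
      open ≤-Reasoning
      consts₁ : ConstsBelowK (constsC S c₁)
      consts₁ = proj₁ (All.++⁻ (constsC S c₁) consts≤K)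
      consts₂ : ConstsBelowK (constsC S c₂)
      consts₂ = proj₂ (All.++⁻ (constsC S c₁) consts≤K)
      oracle≤₁ : oracleMaxC S φ d₁ ≤ Z
      oracle≤₁ = m⊔n≤o⇒m≤o _ _ oracle≤
      D₁ F₁ F₂ : Mono
      D₁ = growthBound ty₁
      F₁ = sizeBound ty₁
      F₂ = sizeBound ty₂
      h₁ : Bounded 1 (X + ⟦ D₁ ⟧ X) μ₁
      h₁ = growthBound-grows ty₁ consts₁ d₁ K≤Z oracle≤₁ Z≤X Z≤X h (Holds-anti (n≤1+n _) h)
    sizeBound-bounds {c = ifte e c₁ c₀} (ty-if _ ty₁ ty₀) consts≤K (ev-if1 g d) {X} K≤Z oracle≤ Z≤X h =
      guarded-size≤ g (sizeBound ty₁) (sizeBound ty₀)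
        (≤-trans (sizeBound-bounds ty₁ (proj₁ (consts-if e c₁ c₀ consts≤K)) d K≤Z (m⊔n≤o⇒n≤o (oracleMaxE S φ g) _ oracle≤) Z≤X h)
                 (⟦⊕⟧ˡ (sizeBound ty₁) (sizeBound ty₀) X))
    sizeBound-bounds {c = ifte e c₁ c₀} (ty-if _ ty₁ ty₀) consts≤K (ev-if0 g d) {X} K≤Z oracle≤ Z≤X h =
      guarded-size≤ g (sizeBound ty₁) (sizeBound ty₀)
        (≤-trans (sizeBound-bounds ty₀ (proj₂ (consts-if e c₁ c₀ consts≤K)) d K≤Z (m⊔n≤o⇒n≤o (oracleMaxE S φ g) _ oracle≤) Z≤X h)
                 (⟦⊕⟧ʳ (sizeBound ty₁) (sizeBound ty₀) X))
    sizeBound-bounds {c = while e c} (ty-wh tye tyc 1≤t _) consts≤K =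
      Loop.sizeWithin tye tyc consts≤K 1≤t _ (growthBound-grows tyc (consts-body e c consts≤K))
        (sizeBound tyc) (sizeBound-bounds tyc (consts-body e c consts≤K))
    sizeBound-bounds {c = while e c} (ty-wh0 tye tyc 1≤t) consts≤K =
      Loop.sizeWithin tye tyc consts≤K 1≤t _ (growthBound-grows tyc (consts-body e c consts≤K))
        (sizeBound tyc) (sizeBound-bounds tyc (consts-body e c consts≤K))

  constantsBound : Cmd S → ℕ
  constantsBound c = suc (totalLength (constsC S c))

  -- With K bounding the constants, m + K ≤ (K + 1)(m + 1) bounds the initial
  -- values, the constants and the oracle answers in terms of m.
  derivationBound : ∀ {c tc tin tout} → ⊢C c tc tin tout → Mono
  derivationBound {c} ty = sizeBound ty ⊙ (suc (constantsBound c) , 1)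

  derivation-size≤ : ∀ {c tc tin tout} (ty : ⊢C c tc tin tout) (φ : Oracle S) {μ μ′} (π : EvalC S φ μ c μ′) →
                     sizeC S φ π ≤ ⟦ derivationBound ty ⟧ (storeSize S μ ⊔ oracleMaxC S φ π)
  derivation-size≤ {c} ty φ {μ} π = begin
    sizeC S φ π                        ≤⟨ sizeBound-bounds ty consts≤K π (m≤n+m K m) (≤-trans (m≤n⊔m _ _) (m≤m+n m K)) ≤-refl bounded ⟩
    ⟦ sizeBound ty ⟧ (m + K)           ≤⟨ ⟦⟧-mono (sizeBound ty) m+K≤ ⟩
    ⟦ sizeBound ty ⟧ (⟦ suc K , 1 ⟧ m) ≤⟨ ⟦⊙⟧ (sizeBound ty) (suc K , 1) m ⟩
    ⟦ derivationBound ty ⟧ m           ∎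
    where
    open ≤-Reasoning
    K m : ℕ
    K = constantsBound c
    m = storeSize S μ ⊔ oracleMaxC S φ π
    open Bounds φ K (s≤s z≤n)
    consts≤K : ConstsBelowK (constsC S c)
    consts≤K = All.map (λ ≤total → ≤-trans ≤total (n≤1+n _)) (length≤totalLength (constsC S c))
    bounded : Bounded 1 (m + K) μ
    bounded = mkHolds λ y _ _ μy → ≤-trans (get≤storeSize S μ y μy) (≤-trans (m≤m⊔n _ _) (m≤m+n m K))
    m+K≤ : m + K ≤ ⟦ suc K , 1 ⟧ m
    m+K≤ = begin
      m + K                ≤⟨ +-mono-≤ (n≤1+n m) (m≤m*n K (suc m)) ⟩
      suc m + K * suc m    ≡⟨ cong (λ z → z + K * z) (*-identityʳ (suc m)) ⟨
      suc K * (suc m * 1)  ∎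

theorem6p9 : (S : Signature) (PT : PolyTimePred S) (Γ : VarEnv S) (Δ : OpEnv S)
    (p : Program S) → SafeProgram S PT Γ Δ p →
    ∃ λ (P : Poly) → (φ : Oracle S) (μ : Store S) (w : W S)
    (π : EvalP S φ μ p w) → sizeP S φ π ≤ evalPoly P (mBound S φ π)
theorem6p9 S PT Γ Δ (c return x) (safe , _ , _ , _ , ty) = toPoly P , bound
  where
  open Safe S PT Γ Δ safe
  P : Mono
  P = constM 1 ⊕ derivationBound ty
  bound : (φ : Oracle S) (μ : Store S) (w : W S) (π : EvalP S φ μ (c return x) w) →
          sizeP S φ π ≤ evalPoly (toPoly P) (mBound S φ π)
  bound φ μ w (ev-prog π _) = begin
    suc (sizeC S φ π)                          ≤⟨ +-mono-≤ (⟦constM⟧ 1 m) (derivation-size≤ ty φ π) ⟩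
    ⟦ constM 1 ⟧ m + ⟦ derivationBound ty ⟧ m  ≤⟨ ⟦⊕⟧ (constM 1) (derivationBound ty) m ⟩
    ⟦ P ⟧ m                                    ≡⟨ evalPoly-toPoly P m ⟨
    evalPoly (toPoly P) m                      ∎
    where
    open ≤-Reasoning
    m : ℕ
    m = storeSize S μ ⊔ oracleMaxC S φ π
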